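{- Let $A$ be a zero-one matrix of size $n\times n$. Then \[\mathrm{RB}^{A^{\circlearrowleft}\# A}(q,t)=\sum_{i=0}^{n}R^{A}_{n-i}(q^2)\,[i]!_{q^2}\,q^{ -i^2}\,t^{i}.\]
   Context: $J^{n,n}$ is the $n\times n$ all-ones matrix; for $n\times n$ matrices $B,A$, $B\# A$ is the $2n\times 2n$ block matrix $\begin{pmatrix}B & J^{n,n}\\ J^{n,n} & A\end{pmatrix}$. For an $a\times b$ matrix $C$, $C^{\circlearrowleft}_{i,j}=C_{a-i+1,b-j+1}$ (rotation by 180 degrees). Permutations $\pi\in\mathfrak{S}_{2n}$ are identified with rook configurations (rook at $(i,j)$ iff $\pi(i)=j$), and $\mathfrak{S}(C)$ for a $2n\times2n$ zero-one matrix $C$ is the set of $\pi\in\mathfrak{S}_{2n}$ with $C_{i,\pi(i)}=1$ for all $i$. Let $\mathfrak{S}^B_n=\{\pi\in\mathfrak{S}_{2n}:\pi(2n+1-i)=2n+1-\pi(i)\text{ for all }i\}$, $\mathrm{inv}(\pi)$ the number of inversions of $\pi\in\mathfrak{S}_{2n}$, and $\mathrm{neg}(\pi)=|\{i\in[n+1,2n]:\pi(i)\le n\}|$. Define $\mathrm{RB}^C(q,t)=\sum_{\pi\in\mathfrak{S}^B_n\cap\mathfrak{S}(C)}q^{\mathrm{inv}(\pi)}t^{\mathrm{neg}(\pi)}$. For a rook configuration $\mathcal{A}$ on $A$ (one-entries, no two in a common row or column), $\mathrm{inv}_A(\mathcal{A})$ is the number of cells $(i,j)$ of $A$ (one- or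 zero-entries) with no rook of $\mathcal{A}$ in row $i$ in a column $\ge j$ and none in column $j$ in a row $\ge i$; $R^A_k(q)=\sum_{\mathcal{A}}q^{\mathrm{inv}_A(\mathcal{A})}$ over configurations with $k$ rooks. $[x]_q=1+q+\dots+q^{x-1}$, $[i]!_q=[1]_q\cdots[i]_q$, $[0]!_q=1$. -}

module Defs where

open import Level using (Level)
open import Data.Bool using (Bool; true; false; if_then_else_; _∧_; not)
open import Data.Nat as ℕ using (ℕ; zero; suc; _<ᵇ_; _∸_)
open import Data.Fin as Fin using (Fin; toℕ; opposite; splitAt)
open import Data.Maybe using (Maybe; just; nothing)
open import Data.Sum using (inj₁; inj₂)
open import Data.List using (List; []; _∷_; map; concatMap; allFin; foldr)
open import Data.Bool.ListAction using (and)
open import Data.Vec.Functional using () renaming (_∷_ to _∷ᶠ_)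
open import Relation.Nullary using (does)
open import Algebra.Bundles using (CommutativeRing)

-- Zero-one matrices (true = one-entry), 0-indexed rows/columns.

Mat : ℕ → ℕ → Set
Mat a b = Fin a → Fin b → Bool

_#_ : ∀ {n} → Mat n n → Mat n n → Mat (n ℕ.+ n) (n ℕ.+ n)
_#_ {n} B A i j with splitAt n i | splitAt n j
... | inj₁ i' | inj₁ j' = B i' j'
... | inj₂ i' | inj₂ j' = A i' j'
... | inj₁ _  | inj₂ _  = true
... | inj₂ _  | inj₁ _  = true

-- rotation by 180 degrees: C↻ i j = C (a-i+1) (b-j+1)  (1-indexed)
rot : ∀ {a b} → Mat a b → Mat a b
rot C i j = C (opposite i) (opposite j)

allFuns : ∀ {A : Set} (m : ℕ) → List A → List (Fin m → A)
allFuns zero    xs = (λ ()) ∷ []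
allFuns (suc m) xs = concatMap (λ x → map (λ f → x ∷ᶠ f) (allFuns m xs)) xs

allB : ∀ {m} → (Fin m → Bool) → Bool
allB {m} p = and (map p (allFin m))

count : ∀ {m} → (Fin m → Bool) → ℕ
count {m} p = foldr (λ i acc → if p i then suc acc else acc) 0 (allFin m)

count2 : ∀ {m k} → (Fin m → Fin k → Bool) → ℕ
count2 {m} p = foldr (λ i acc → count (p i) ℕ.+ acc) 0 (allFin m)

_==_ : ∀ {m} → Fin m → Fin m → Bool
i == j = does (i Fin.≟ j)

_<F_ : ∀ {m} → Fin m → Fin m → Bool
i <F j = toℕ i <ᵇ toℕ j

isPerm : ∀ {m} → (Fin m → Fin m) → Bool
isPerm π = allB (λ i → allB (λ j → not (π i == π j) ∨' (i == j)))
  where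
  _∨'_ : Bool → Bool → Bool
  true ∨' _ = true
  false ∨' b = b

allPerms : (m : ℕ) → List (Fin m → Fin m)
allPerms m = Data.List.filterᵇ isPerm (allFuns m (allFin m))
  where import Data.List

-- type B condition  π(2n+1-i) = 2n+1-π(i)
isTypeB : ∀ {m} → (Fin m → Fin m) → Bool
isTypeB π = allB (λ i → π (opposite i) == opposite (π i))

inS : ∀ {m} → Mat m m → (Fin m → Fin m) → Bool
inS C π = allB (λ i → C i (π i))

inv : ∀ {m} → (Fin m → Fin m) → ℕ
inv π = count2 (λ i j → (i <F j) ∧ (π j <F π i))

-- neg π = #{ i ∈ [n+1,2n] : π(i) ≤ n }  (0-indexed: i ≥ n, π i < n)
neg : ∀ n → (Fin (n ℕ.+ n) → Fin (n ℕ.+ n)) → ℕ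
neg n π = count (λ i → (n <ᵇ suc (toℕ i)) ∧ (toℕ (π i) <ᵇ n))

-- Rook configurations on an n×n board: row i ↦ column of its rook (if any)

isRookConf : ∀ {n} → Mat n n → (Fin n → Maybe (Fin n)) → Bool
isRookConf {n} A f = allB (λ i → okRow i (f i))
  where
  okRow : Fin n → Maybe (Fin n) → Bool
  okRow i nothing  = true
  okRow i (just j) = A i j ∧ allB (λ i' → (i' == i) ∨'' notAt (f i') j)
    where
    _∨''_ : Bool → Bool → Bool
    true ∨'' _ = true
    false ∨'' b = b
    notAt : Maybe (Fin n) → Fin n → Bool
    notAt nothing  _ = true
    notAt (just k) j = not (k == j)

allRookConfs : ∀ {n} → Mat n n → List (Fin n → Maybe (Fin n))
allRookConfs {n} A =
  Data.List.filterᵇ (isRookConf A) (allFuns n (nothing ∷ map just (allFin n)))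
  where import Data.List

rooks : ∀ {n} → (Fin n → Maybe (Fin n)) → ℕ
rooks f = count (λ i → isJ (f i))
  where
  isJ : ∀ {X : Set} → Maybe X → Bool
  isJ nothing = false
  isJ (just _) = true

invA : ∀ {n} → (Fin n → Maybe (Fin n)) → ℕ
invA {n} f = count2 (λ i j → rowFree i j ∧ colFree i j)
  where
  rowFree : Fin n → Fin n → Bool
  rowFree i j with f i
  ... | nothing = true
  ... | just k  = k <F j
  colFree : Fin n → Fin n → Bool
  colFree i j = allB (λ i' → (i' <F i) ∨₀ notAt (f i'))
    where
    _∨₀_ : Bool → Bool → Bool
    true ∨₀ _ = true
    false ∨₀ b = b
    notAt : Maybe (Fin n) → Bool
    notAt nothing  = true
    notAt (just k) = not (k == j)

module Eval {c ℓ : Level} (R : CommutativeRing c ℓ) where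
  open CommutativeRing R

  pow : Carrier → ℕ → Carrier
  pow x zero    = 1#
  pow x (suc k) = x * pow x k

  sumL : ∀ {X : Set} → List X → (X → Carrier) → Carrier
  sumL xs f = foldr (λ x acc → f x + acc) 0# xs

  sumTo : ℕ → (ℕ → Carrier) → Carrier
  sumTo zero    f = f 0
  sumTo (suc n) f = sumTo n f + f (suc n)

  qint : Carrier → ℕ → Carrier
  qint q zero    = 0#
  qint q (suc x) = qint q x + pow q x

  qfact : Carrier → ℕ → Carrier
  qfact q zero    = 1#
  qfact q (suc i) = qfact q i * qint q (suc i)

  RB : ∀ n → Mat (n ℕ.+ n) (n ℕ.+ n) → Carrier → Carrier → Carrier
  RB n C q t = sumL (allPerms (n ℕ.+ n))
    (λ π → if isTypeB π ∧ inS C π then pow q (inv π) * pow t (neg n π) else 0#)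

  RA : ∀ {n} → Mat n n → ℕ → Carrier → Carrier
  RA A k q = sumL (allRookConfs A)
    (λ f → if does (rooks f ℕ.≟ k) then pow q (invA f) else 0#)

-- A type B permutation π of [2n] is determined by its bottom half, and π ∈ 𝔖(A↻ # A) exactly
-- when every bottom row s either carries a rook of A (π s = n + c with A s c = 1) or is free and
-- goes to a column e s of the left all-ones block. With f the resulting rook placement on A,
-- π is a permutation iff f is a rook placement and e injects the i free rows into the i columns
-- whose mirror images carry no rook. Then neg π = i, and counting inversions pair by pair over the
-- bottom rows gives inv π + i² = 2 inv_A(f) + 2 inv(e); placing the free rows one at a time shows
-- that the sum of q^(2 inv(e)) over these injections is [i]!_{q²}. Grouping rook placements by
-- their number n - i of rooks yields the right-hand side.

module Submission where

open import Defs
open import Level using (Level)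
open import Data.Nat using (ℕ; _∸_)
open import Data.Fin using (Fin)
open import Algebra.Bundles using (CommutativeRing)
open import Algebra.Bundles using (Semiring)

module FinSum {c ℓ} (S : Semiring c ℓ) where
  open import Data.Nat as ℕ using (zero; suc)
  open import Data.Fin as Fin using (opposite; _↑ˡ_; _↑ʳ_)
  import Data.Fin.Properties as FinP
  import Data.Fin.Permutation as Perm
  open import Relation.Binary.PropositionalEquality using (_≢_)
  import Function
  open Semiring S
  open import Algebra.Properties.Semiring.Sum S public
  open import Relation.Binary.Reasoning.Setoid setoid

  sum-↑ : ∀ a b (h : Fin (a ℕ.+ b) → Carrier) → sum h ≈ sum (λ i → h (i ↑ˡ b)) + sum (λ j → h (a ↑ʳ j))
  sum-↑ zero    b h = sym (+-identityˡ _)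
  sum-↑ (suc a) b h = trans (+-congˡ (sum-↑ a b (λ i → h (Fin.suc i)))) (sym (+-assoc _ _ _))

  sum-opposite : ∀ {m} (h : Fin m → Carrier) → sum (λ i → h (opposite i)) ≈ sum h
  sum-opposite h = sym (∑-permute h Perm.reverse)

  sum-eq-single : ∀ {m} (h : Fin m → Carrier) (c : Fin m) → (∀ y → y ≢ c → h y ≈ 0#) → sum h ≈ h c
  sum-eq-single {suc m} h Fin.zero vanish = begin
    h Fin.zero + sum (λ i → h (Fin.suc i)) ≈⟨ +-congˡ (sum-cong-≋ (λ i → vanish (Fin.suc i) (λ ()))) ⟩
    h Fin.zero + sum {m} (λ _ → 0#)        ≈⟨ +-congˡ (sum-replicate-zero m) ⟩
    h Fin.zero + 0#                        ≈⟨ +-identityʳ _ ⟩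
    h Fin.zero                             ∎
  sum-eq-single {suc m} h (Fin.suc c) vanish = begin
    h Fin.zero + sum (λ i → h (Fin.suc i)) ≈⟨ +-congʳ (vanish Fin.zero (λ ())) ⟩
    0# + sum (λ i → h (Fin.suc i))         ≈⟨ +-identityˡ _ ⟩
    sum (λ i → h (Fin.suc i))              ≈⟨ sum-eq-single (λ i → h (Fin.suc i)) c
                                                (λ y y≢c → vanish (Fin.suc y) (y≢c Function.∘ FinP.suc-injective)) ⟩
    h (Fin.suc c)                          ∎

module Counting where
  open import Data.Bool using (Bool; true; false; if_then_else_; _∧_; _∨_; not)
  import Data.Bool.Properties as 𝔹
  open import Data.Nat using (zero; suc; _+_; _≤_; z≤n)
  import Data.Nat.Properties as ℕP
  import Data.Fin as Fin
  import Data.Fin.Properties as FinP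
  open import Data.Maybe using (Maybe; just; nothing; maybe′)
  open import Data.Product using (Σ; _×_; _,_; proj₁; proj₂)
  open import Data.Sum using (_⊎_; inj₁; inj₂)
  open import Data.Empty using (⊥-elim)
  open import Data.List using (map; foldr; tabulate)
  open import Data.Bool.ListAction using (and)
  open import Relation.Nullary using (yes)
  open import Relation.Nullary.Decidable using (dec-true; dec-false)
  open import Relation.Binary.PropositionalEquality
  import Function

  module ℕ∑ = FinSum ℕP.+-*-semiring

  χ : Bool → ℕ
  χ true  = 1
  χ false = 0

  #_ : ∀ {m} → (Fin m → Bool) → ℕ
  # p = ℕ∑.sum (λ i → χ (p i))

  ∧-true : ∀ {a b} → a ∧ b ≡ true → a ≡ true × b ≡ true
  ∧-true {true} {true} _ = refl , refl

  ∧-false : ∀ {a b} → a ∧ b ≡ false → a ≡ false ⊎ b ≡ false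
  ∧-false {false} _ = inj₁ refl
  ∧-false {true}  e = inj₂ e

  true-∧ : ∀ {a b} → a ≡ true → b ≡ true → a ∧ b ≡ true
  true-∧ refl refl = refl

  bool-ext : ∀ {a b} → (a ≡ true → b ≡ true) → (b ≡ true → a ≡ true) → a ≡ b
  bool-ext {true}  {true}  _ _ = refl
  bool-ext {true}  {false} f _ = sym (f refl)
  bool-ext {false} {true}  _ g = g refl
  bool-ext {false} {false} _ _ = refl

  false≢true : false ≢ true
  false≢true ()

  not-true : ∀ {a} → not a ≡ true → a ≢ true
  not-true {false} _ ()

  true-not : ∀ {a} → a ≢ true → not a ≡ true
  true-not {a} a≢true = cong not (𝔹.¬-not a≢true)

  ==-refl : ∀ {m} (i : Fin m) → (i == i) ≡ true
  ==-refl i = dec-true (i Fin.≟ i) refl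

  ==-sound : ∀ {m} {i j : Fin m} → (i == j) ≡ true → i ≡ j
  ==-sound {i = i} {j} e with i Fin.≟ j
  ... | yes i≡j = i≡j

  ==-false : ∀ {m} {i j : Fin m} → i ≢ j → (i == j) ≡ false
  ==-false {i = i} {j} = dec-false (i Fin.≟ j)

  χ-mono : ∀ {a b} → (a ≡ true → b ≡ true) → χ a ≤ χ b
  χ-mono {false} _ = z≤n
  χ-mono {true}  f rewrite f refl = ℕP.≤-refl

  #-cong : ∀ {m} {p q : Fin m → Bool} → (∀ i → p i ≡ q i) → # p ≡ # q
  #-cong p≗q = ℕ∑.sum-cong-≗ (λ i → cong χ (p≗q i))

  #-false : ∀ {m} {p : Fin m → Bool} → (∀ i → p i ≡ false) → # p ≡ 0
  #-false {m} p≗false = trans (#-cong p≗false) (ℕ∑.sum-replicate-zero m)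

  #-mono : ∀ {m} {p q : Fin m → Bool} → (∀ i → p i ≡ true → q i ≡ true) → # p ≤ # q
  #-mono {zero}  _   = z≤n
  #-mono {suc m} p⊆q = ℕP.+-mono-≤ (χ-mono (p⊆q Fin.zero)) (#-mono (λ i → p⊆q (Fin.suc i)))

  #-∨ : ∀ {m} (p q : Fin m → Bool) → (∀ i → p i ∧ q i ≡ false) →
        # (λ i → p i ∨ q i) ≡ # p + # q
  #-∨ p q disjoint = trans (ℕ∑.sum-cong-≗ (λ i → χ-∨ (p i) (q i) (disjoint i)))
                           (ℕ∑.∑-distrib-+ (λ i → χ (p i)) (λ i → χ (q i)))
    where
    χ-∨ : ∀ a b → a ∧ b ≡ false → χ (a ∨ b) ≡ χ a + χ b
    χ-∨ true  false _ = refl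
    χ-∨ false _     _ = refl

  #-+-#-not : ∀ {m} (p : Fin m → Bool) → # p + # (λ i → not (p i)) ≡ m
  #-+-#-not {m} p = begin
    # p + # (λ i → not (p i))          ≡⟨ ℕ∑.∑-distrib-+ (λ i → χ (p i)) (λ i → χ (not (p i))) ⟨
    ℕ∑.sum (λ i → χ (p i) + χ (not (p i))) ≡⟨ ℕ∑.sum-cong-≗ (λ i → χ-+-χ-not (p i)) ⟩
    ℕ∑.sum {m} (λ _ → 1)                  ≡⟨ sum-ones m ⟩
    m                                     ∎
    where
    open ≡-Reasoning
    sum-ones : ∀ k → ℕ∑.sum {k} (λ _ → 1) ≡ k
    sum-ones zero    = refl
    sum-ones (suc k) = cong suc (sum-ones k)
    χ-+-χ-not : ∀ a → χ a + χ (not a) ≡ 1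
    χ-+-χ-not true  = refl
    χ-+-χ-not false = refl

  #-singleton : ∀ {m} (y : Fin m) (q : Fin m → Bool) → # (λ i → (y == i) ∧ q i) ≡ χ (q y)
  #-singleton {suc m} Fin.zero q = trans
    (cong (χ (q Fin.zero) +_) (#-false {p = λ i → (Fin.zero == Fin.suc i) ∧ q (Fin.suc i)} (λ _ → refl)))
    (ℕP.+-identityʳ _)
  #-singleton {suc m} (Fin.suc y) q = #-singleton y (λ i → q (Fin.suc i))

  ∀ᵇ : ∀ {m} → (Fin m → Bool) → Bool
  ∀ᵇ {zero}  p = true
  ∀ᵇ {suc m} p = p Fin.zero ∧ ∀ᵇ (λ i → p (Fin.suc i))

  ∃ᵇ : ∀ {m} → (Fin m → Bool) → Bool
  ∃ᵇ {zero}  p = false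
  ∃ᵇ {suc m} p = p Fin.zero ∨ ∃ᵇ (λ i → p (Fin.suc i))

  ∀ᵇ-true : ∀ {m} {p : Fin m → Bool} → ∀ᵇ p ≡ true → ∀ i → p i ≡ true
  ∀ᵇ-true {suc m} e Fin.zero    = proj₁ (∧-true e)
  ∀ᵇ-true {suc m} e (Fin.suc i) = ∀ᵇ-true (proj₂ (∧-true e)) i

  true-∀ᵇ : ∀ {m} {p : Fin m → Bool} → (∀ i → p i ≡ true) → ∀ᵇ p ≡ true
  true-∀ᵇ {zero}  _ = refl
  true-∀ᵇ {suc m} f = true-∧ (f Fin.zero) (true-∀ᵇ (λ i → f (Fin.suc i)))

  ∃ᵇ-true : ∀ {m} {p : Fin m → Bool} → ∃ᵇ p ≡ true → Σ (Fin m) (λ i → p i ≡ true)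
  ∃ᵇ-true {suc m} {p} e with p Fin.zero in p0
  ... | true  = Fin.zero , p0
  ... | false = let (i , pi) = ∃ᵇ-true e in Fin.suc i , pi

  true-∃ᵇ : ∀ {m} {p : Fin m → Bool} (i : Fin m) → p i ≡ true → ∃ᵇ p ≡ true
  true-∃ᵇ {suc m} Fin.zero    e rewrite e = refl
  true-∃ᵇ {suc m} {p} (Fin.suc i) e with p Fin.zero
  ... | true  = refl
  ... | false = true-∃ᵇ i e

  ∀ᵇ-cong : ∀ {m} {p q : Fin m → Bool} → (∀ i → p i ≡ q i) → ∀ᵇ p ≡ ∀ᵇ q
  ∀ᵇ-cong {zero}  _   = refl
  ∀ᵇ-cong {suc m} p≗q = cong₂ _∧_ (p≗q Fin.zero) (∀ᵇ-cong (λ i → p≗q (Fin.suc i)))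

  ∀ᵇ-∨-not : ∀ {m} (a b : Fin m → Bool) → ∀ᵇ (λ i → a i ∨ not (b i)) ≡ not (∃ᵇ (λ i → not (a i) ∧ b i))
  ∀ᵇ-∨-not {zero}  a b = refl
  ∀ᵇ-∨-not {suc m} a b with a Fin.zero | b Fin.zero
  ... | true  | _     = ∀ᵇ-∨-not (λ i → a (Fin.suc i)) (λ i → b (Fin.suc i))
  ... | false | true  = refl
  ... | false | false = ∀ᵇ-∨-not (λ i → a (Fin.suc i)) (λ i → b (Fin.suc i))

  ∃ᵇ-split : ∀ {m} (a p : Fin m → Bool) → ∃ᵇ p ≡ ∃ᵇ (λ i → a i ∧ p i) ∨ ∃ᵇ (λ i → not (a i) ∧ p i)
  ∃ᵇ-split {zero}  a p = refl
  ∃ᵇ-split {suc m} a p with a Fin.zero | p Fin.zero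
  ... | true  | true  = refl
  ... | true  | false = ∃ᵇ-split (λ i → a (Fin.suc i)) (λ i → p (Fin.suc i))
  ... | false | true  = sym (𝔹.∨-zeroʳ _)
  ... | false | false = ∃ᵇ-split (λ i → a (Fin.suc i)) (λ i → p (Fin.suc i))

  allB-∀ᵇ : ∀ {m} (p : Fin m → Bool) → allB p ≡ ∀ᵇ p
  allB-∀ᵇ = go Function.id
    where
    go : ∀ {m M} (g : Fin m → Fin M) (p : Fin M → Bool) → and (map p (tabulate g)) ≡ ∀ᵇ (λ i → p (g i))
    go {zero}  g p = refl
    go {suc m} g p = cong (p (g Fin.zero) ∧_) (go (λ i → g (Fin.suc i)) p)

  allB-true : ∀ {m} {p : Fin m → Bool} → allB p ≡ true → ∀ i → p i ≡ true
  allB-true {p = p} e = ∀ᵇ-true (trans (sym (allB-∀ᵇ p)) e)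

  true-allB : ∀ {m} {p : Fin m → Bool} → (∀ i → p i ≡ true) → allB p ≡ true
  true-allB {p = p} f = trans (allB-∀ᵇ p) (true-∀ᵇ f)

  allB-false : ∀ {m} {p : Fin m → Bool} → allB p ≡ false → Σ (Fin m) (λ i → p i ≡ false)
  allB-false {p = p} e = ∀ᵇ-false (trans (sym (allB-∀ᵇ p)) e)
    where
    ∀ᵇ-false : ∀ {m} {p : Fin m → Bool} → ∀ᵇ p ≡ false → Σ (Fin m) (λ i → p i ≡ false)
    ∀ᵇ-false {suc m} {p} e with p Fin.zero in p₀
    ... | false = Fin.zero , p₀
    ... | true  = let (i , pᵢ) = ∀ᵇ-false e in Fin.suc i , pᵢ

  count-# : ∀ {m} (p : Fin m → Bool) → count p ≡ # p
  count-# = go Function.id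
    where
    go : ∀ {m M} (g : Fin m → Fin M) (p : Fin M → Bool) →
         foldr (λ i acc → if p i then suc acc else acc) 0 (tabulate g) ≡ # (λ i → p (g i))
    go {zero}  g p = refl
    go {suc m} g p with p (g Fin.zero)
    ... | true  = cong suc (go (λ i → g (Fin.suc i)) p)
    ... | false = go (λ i → g (Fin.suc i)) p

  count2-∑# : ∀ {m k} (p : Fin m → Fin k → Bool) → count2 p ≡ ℕ∑.sum (λ i → # p i)
  count2-∑# = go Function.id
    where
    go : ∀ {m M k} (g : Fin m → Fin M) (p : Fin M → Fin k → Bool) →
         foldr (λ i acc → count (p i) + acc) 0 (tabulate g) ≡ ℕ∑.sum (λ i → # p (g i))
    go {zero}  g p = refl
    go {suc m} g p = cong₂ _+_ (count-# (p (g Fin.zero))) (go (λ i → g (Fin.suc i)) p)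

  +-≤-≤-≡ : ∀ {a b c d} → a ≤ c → b ≤ d → a + b ≡ c + d → a ≡ c × b ≡ d
  +-≤-≤-≡ {a} {b} {c} {d} a≤c b≤d eq with ℕP.m≤n⇒m<n∨m≡n a≤c
  ... | inj₂ refl = refl , ℕP.+-cancelˡ-≡ a b d eq
  ... | inj₁ a<c  = ⊥-elim (ℕP.<-irrefl eq (ℕP.+-mono-<-≤ a<c b≤d))

  #-≡⇒⊇ : ∀ {m} {p q : Fin m → Bool} → (∀ i → p i ≡ true → q i ≡ true) → # p ≡ # q →
          ∀ i → q i ≡ true → p i ≡ true
  #-≡⇒⊇ {suc m} {p} {q} p⊆q #p≡#q = at
    where
    heads-tails : χ (p Fin.zero) ≡ χ (q Fin.zero) × # (λ i → p (Fin.suc i)) ≡ # (λ i → q (Fin.suc i))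
    heads-tails = +-≤-≤-≡ (χ-mono (p⊆q Fin.zero)) (#-mono (λ j → p⊆q (Fin.suc j))) #p≡#q
    χ-true : ∀ {a} → χ a ≡ 1 → a ≡ true
    χ-true {true} _ = refl
    at : ∀ i → q i ≡ true → p i ≡ true
    at Fin.zero    qi = χ-true (trans (proj₁ heads-tails) (cong χ qi))
    at (Fin.suc i) qi = #-≡⇒⊇ (λ j → p⊆q (Fin.suc j)) (proj₂ heads-tails) i qi

  _≡ᵇjust_ : ∀ {b} → Maybe (Fin b) → Fin b → Bool
  m ≡ᵇjust y = maybe′ (_== y) false m

  ≡ᵇjust-sound : ∀ {b} (m : Maybe (Fin b)) {y} → m ≡ᵇjust y ≡ true → m ≡ just y
  ≡ᵇjust-sound (just z) e = cong just (==-sound e)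

  ≡ᵇjust-complete : ∀ {b} {m : Maybe (Fin b)} {y} → m ≡ just y → m ≡ᵇjust y ≡ true
  ≡ᵇjust-complete {y = y} refl = ==-refl y

  InjectiveOn : ∀ {a b} → (Fin a → Bool) → (Fin a → Maybe (Fin b)) → Set
  InjectiveOn P g = ∀ {x x' y} → P x ≡ true → P x' ≡ true → g x ≡ just y → g x' ≡ just y → x ≡ x'

  #-image : ∀ {a b} (P : Fin a → Bool) (g : Fin a → Maybe (Fin b)) (Q : Fin b → Bool) → InjectiveOn P g →
            # (λ y → ∃ᵇ (λ x → P x ∧ (g x ≡ᵇjust y)) ∧ Q y) ≡ # (λ x → P x ∧ maybe′ Q false (g x))
  #-image {zero} {b} P g Q inj = #-false {b} (λ _ → refl)
  #-image {suc a} {b} P g Q inj = begin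
    # (λ y → (hit₀ y ∨ hit₊ y) ∧ Q y)               ≡⟨ #-cong (λ y → 𝔹.∧-distribʳ-∨ (Q y) (hit₀ y) (hit₊ y)) ⟩
    # (λ y → hit₀ y ∧ Q y ∨ hit₊ y ∧ Q y)             ≡⟨ #-∨ _ _ disjoint ⟩
    # (λ y → hit₀ y ∧ Q y) + # (λ y → hit₊ y ∧ Q y)   ≡⟨ cong₂ _+_ (first (P Fin.zero) (g Fin.zero))
                                                           (#-image (λ x → P (Fin.suc x)) (λ x → g (Fin.suc x)) Q
                                                             (λ p p' e e' → FinP.suc-injective (inj p p' e e'))) ⟩
    χ (P Fin.zero ∧ maybe′ Q false (g Fin.zero)) + _  ∎
    where
    open ≡-Reasoning
    hit₀ hit₊ : Fin b → Bool
    hit₀ y = P Fin.zero ∧ (g Fin.zero ≡ᵇjust y)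
    hit₊ y = ∃ᵇ (λ x → P (Fin.suc x) ∧ (g (Fin.suc x) ≡ᵇjust y))
    disjoint : ∀ y → (hit₀ y ∧ Q y) ∧ (hit₊ y ∧ Q y) ≡ false
    disjoint y = 𝔹.¬-not λ both →
      let h₀ , h₊ = ∧-true both
          p₀ , g₀ = ∧-true (proj₁ (∧-true h₀))
          x , hx  = ∃ᵇ-true (proj₁ (∧-true h₊))
          pₓ , gₓ = ∧-true hx
      in FinP.0≢1+n (inj p₀ pₓ (≡ᵇjust-sound (g Fin.zero) g₀) (≡ᵇjust-sound (g (Fin.suc x)) gₓ))
    first : ∀ p₀ m → # (λ y → (p₀ ∧ (m ≡ᵇjust y)) ∧ Q y) ≡ χ (p₀ ∧ maybe′ Q false m)
    first false _        = #-false {b} (λ _ → refl)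
    first true  nothing  = #-false {b} (λ _ → refl)
    first true  (just z) = #-singleton z Q

module FinOrder where
  open import Data.Bool using (true; false)
  import Data.Bool.Properties as 𝔹
  open import Data.Nat as ℕ using (zero; suc; _+_; _<ᵇ_; _<_; s≤s)
  import Data.Nat.Properties as ℕP
  open import Data.Fin as Fin using (toℕ; opposite; splitAt; _↑ˡ_; _↑ʳ_)
  import Data.Fin.Properties as FinP
  open import Data.Sum using (inj₁; inj₂)
  open import Function.Bundles using (module Equivalence)
  open import Relation.Nullary using (¬_)
  open import Relation.Binary.PropositionalEquality
  open Counting using (bool-ext)

  <ᵇ-true : ∀ {a b} → a < b → (a <ᵇ b) ≡ true
  <ᵇ-true a<b = Equivalence.to 𝔹.T-≡ (ℕP.<⇒<ᵇ a<b)

  <ᵇ-false : ∀ {a b} → ¬ a < b → (a <ᵇ b) ≡ false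
  <ᵇ-false {a} {b} a≮b = 𝔹.¬-not (λ e → a≮b (ℕP.<ᵇ⇒< a b (Equivalence.from 𝔹.T-≡ e)))

  <ᵇ-ext : ∀ {a b c d} → (a < b → c < d) → (c < d → a < b) → (a <ᵇ b) ≡ (c <ᵇ d)
  <ᵇ-ext {a} {b} {c} {d} to from = bool-ext
    (λ e → <ᵇ-true (to (ℕP.<ᵇ⇒< a b (Equivalence.from 𝔹.T-≡ e))))
    (λ e → <ᵇ-true (from (ℕP.<ᵇ⇒< c d (Equivalence.from 𝔹.T-≡ e))))

  <F-irrefl : ∀ {m} (i : Fin m) → (i <F i) ≡ false
  <F-irrefl i = <ᵇ-false {toℕ i} (ℕP.<-irrefl refl)

  suc+opposite : ∀ {m} (i : Fin m) → suc (toℕ i + toℕ (opposite i)) ≡ m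
  suc+opposite i = trans (ℕP.+-comm (suc (toℕ i)) _)
                         (trans (cong (_+ suc (toℕ i)) (FinP.opposite-prop i)) (ℕP.m∸n+n≡m (FinP.toℕ<n i)))

  <F-opposite : ∀ {m} (x y : Fin m) → (y <F opposite x) ≡ (suc (toℕ x + toℕ y) <ᵇ m)
  <F-opposite {m} x y = <ᵇ-ext to from
    where
    to : toℕ y < toℕ (opposite x) → suc (toℕ x + toℕ y) < m
    to y<x̄ = subst (suc (toℕ x + toℕ y) <_) (suc+opposite x) (ℕP.+-monoʳ-< (suc (toℕ x)) y<x̄)
    from : suc (toℕ x + toℕ y) < m → toℕ y < toℕ (opposite x)
    from lt = ℕP.+-cancelˡ-< (suc (toℕ x)) _ _ (subst (suc (toℕ x + toℕ y) <_) (sym (suc+opposite x)) lt)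

  <F-opposite-comm : ∀ {m} (x y : Fin m) → (y <F opposite x) ≡ (x <F opposite y)
  <F-opposite-comm {m} x y = trans (<F-opposite x y)
    (trans (cong (λ k → suc k <ᵇ m) (ℕP.+-comm (toℕ x) (toℕ y))) (sym (<F-opposite y x)))

  opposite-<F : ∀ {m} (x y : Fin m) → (opposite x <F opposite y) ≡ (y <F x)
  opposite-<F {m} x y = trans (<F-opposite y (opposite x)) (<ᵇ-ext to from)
    where
    x̄ : ℕ
    x̄ = toℕ (opposite x)
    to : suc (toℕ y + x̄) < m → toℕ y < toℕ x
    to lt = ℕP.+-cancelʳ-< x̄ (toℕ y) (toℕ x) (ℕ.s<s⁻¹ (subst (suc (toℕ y + x̄) <_) (sym (suc+opposite x)) lt))
    from : toℕ y < toℕ x → suc (toℕ y + x̄) < m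
    from y<x = subst (suc (toℕ y + x̄) <_) (suc+opposite x) (s≤s (ℕP.+-monoˡ-< x̄ y<x))

  opposite-injective : ∀ {m} {i j : Fin m} → opposite i ≡ opposite j → i ≡ j
  opposite-injective {i = i} {j} e =
    trans (sym (FinP.opposite-involutive i)) (trans (cong opposite e) (FinP.opposite-involutive j))

  data JoinView (a b : ℕ) : Fin (a + b) → Set where
    left  : (i : Fin a) → JoinView a b (i ↑ˡ b)
    right : (j : Fin b) → JoinView a b (a ↑ʳ j)

  joinView : ∀ a b (x : Fin (a + b)) → JoinView a b x
  joinView a b x with splitAt a x in eq
  ... | inj₁ i = subst (JoinView a b) (FinP.splitAt⁻¹-↑ˡ eq) (left i)
  ... | inj₂ j = subst (JoinView a b) (FinP.splitAt⁻¹-↑ʳ eq) (right j)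

  ↑ˡ≢↑ʳ : ∀ {a b} (i : Fin a) (j : Fin b) → i ↑ˡ b ≢ a ↑ʳ j
  ↑ˡ≢↑ʳ {a} {b} i j e = ℕP.<-irrefl (cong toℕ e)
    (subst₂ _<_ (sym (FinP.toℕ-↑ˡ i b)) (sym (FinP.toℕ-↑ʳ a j)) (ℕP.≤-trans (FinP.toℕ<n i) (ℕP.m≤m+n a (toℕ j))))

  ↑ˡ-<F-↑ˡ : ∀ {a} b (i j : Fin a) → ((i ↑ˡ b) <F (j ↑ˡ b)) ≡ (i <F j)
  ↑ˡ-<F-↑ˡ b i j rewrite FinP.toℕ-↑ˡ i b | FinP.toℕ-↑ˡ j b = refl

  ↑ʳ-<F-↑ʳ : ∀ {b} a (i j : Fin b) → ((a ↑ʳ i) <F (a ↑ʳ j)) ≡ (i <F j)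
  ↑ʳ-<F-↑ʳ zero    i j = refl
  ↑ʳ-<F-↑ʳ (suc a) i j = ↑ʳ-<F-↑ʳ a i j

  ↑ˡ-<F-↑ʳ : ∀ {a b} (i : Fin a) (j : Fin b) → ((i ↑ˡ b) <F (a ↑ʳ j)) ≡ true
  ↑ˡ-<F-↑ʳ {a} {b} i j rewrite FinP.toℕ-↑ˡ i b | FinP.toℕ-↑ʳ a j =
    <ᵇ-true (ℕP.≤-trans (FinP.toℕ<n i) (ℕP.m≤m+n a (toℕ j)))

  ↑ʳ-<F-↑ˡ : ∀ {a b} (j : Fin b) (i : Fin a) → ((a ↑ʳ j) <F (i ↑ˡ b)) ≡ false
  ↑ʳ-<F-↑ˡ {a} {b} j i rewrite FinP.toℕ-↑ˡ i b | FinP.toℕ-↑ʳ a j =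
    <ᵇ-false (ℕP.<-asym (ℕP.≤-trans (FinP.toℕ<n i) (ℕP.m≤m+n a (toℕ j))))

  opposite-↑ʳ : ∀ n (c : Fin n) → opposite (n ↑ʳ c) ≡ opposite c ↑ˡ n
  opposite-↑ʳ n c = FinP.toℕ-injective (begin
    toℕ (opposite (n ↑ʳ c))       ≡⟨ FinP.opposite-prop (n ↑ʳ c) ⟩
    (n + n) ∸ suc (toℕ (n ↑ʳ c))  ≡⟨ cong (λ k → (n + n) ∸ suc k) (FinP.toℕ-↑ʳ n c) ⟩
    (n + n) ∸ suc (n + toℕ c)     ≡⟨ cong ((n + n) ∸_) (ℕP.+-suc n (toℕ c)) ⟨
    (n + n) ∸ (n + suc (toℕ c))   ≡⟨ ℕP.[m+n]∸[m+o]≡n∸o n n (suc (toℕ c)) ⟩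
    n ∸ suc (toℕ c)               ≡⟨ FinP.opposite-prop c ⟨
    toℕ (opposite c)              ≡⟨ FinP.toℕ-↑ˡ (opposite c) n ⟨
    toℕ (opposite c ↑ˡ n)         ∎)
    where open ≡-Reasoning

  opposite-↑ˡ : ∀ n (r : Fin n) → opposite (r ↑ˡ n) ≡ n ↑ʳ opposite r
  opposite-↑ˡ n r = trans
    (cong opposite (sym (trans (opposite-↑ʳ n (opposite r)) (cong (_↑ˡ n) (FinP.opposite-involutive r)))))
    (FinP.opposite-involutive _)

module ListSums {c ℓ} (R : CommutativeRing c ℓ) where
  open import Data.Bool using (Bool; true; false; if_then_else_)
  open import Data.Nat as ℕ using (zero; suc)
  import Data.Nat.Properties as ℕP
  open import Relation.Nullary using (yes; no)
  open import Data.Fin as Fin using (splitAt)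
  open import Data.Sum using (inj₁; inj₂)
  open import Data.List using (List; []; _∷_; map; tabulate; allFin; concatMap; _++_; filterᵇ)
  open import Data.Vec.Functional using () renaming (_∷_ to _∷ᶠ_; _++_ to _++ᶠ_)
  open import Relation.Binary.PropositionalEquality as ≡ using (_≡_; _≢_)
  open import Data.Empty using (⊥-elim)
  open CommutativeRing R
  open import Algebra.Properties.CommutativeSemigroup +-commutativeSemigroup using (interchange)
  open import Relation.Binary.Reasoning.Setoid setoid
  open Eval R
  open FinSum semiring
  open Counting using (∀ᵇ)

  Extensional : ∀ {k} {X : Set} → ((Fin k → X) → Carrier) → Set _
  Extensional {k} F = ∀ {f g} → (∀ i → f i ≡ g i) → F f ≈ F g

  sumL-cong : ∀ {X : Set} (xs : List X) {f g : X → Carrier} → (∀ x → f x ≈ g x) → sumL xs f ≈ sumL xs g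
  sumL-cong []       f≈g = refl
  sumL-cong (x ∷ xs) f≈g = +-cong (f≈g x) (sumL-cong xs f≈g)

  guarded-cong : ∀ {b b' : Bool} {a a'} → b ≡ b' → a ≈ a' → (if b then a else 0#) ≈ (if b' then a' else 0#)
  guarded-cong {true}  ≡.refl a≈a' = a≈a'
  guarded-cong {false} ≡.refl _    = refl

  sumL-zero : ∀ {X : Set} (xs : List X) {f : X → Carrier} → (∀ x → f x ≈ 0#) → sumL xs f ≈ 0#
  sumL-zero []       f≈0 = refl
  sumL-zero (x ∷ xs) f≈0 = trans (+-cong (f≈0 x) (sumL-zero xs f≈0)) (+-identityˡ 0#)

  sumL-+ : ∀ {X : Set} (xs : List X) (f g : X → Carrier) → sumL xs (λ x → f x + g x) ≈ sumL xs f + sumL xs g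
  sumL-+ []       f g = sym (+-identityˡ 0#)
  sumL-+ (x ∷ xs) f g = trans (+-congˡ (sumL-+ xs f g)) (interchange (f x) (g x) _ _)

  *-distribˡ-sumL : ∀ {X : Set} (xs : List X) (a : Carrier) (f : X → Carrier) → a * sumL xs f ≈ sumL xs (λ x → a * f x)
  *-distribˡ-sumL []       a f = zeroʳ a
  *-distribˡ-sumL (x ∷ xs) a f = trans (distribˡ a (f x) _) (+-congˡ (*-distribˡ-sumL xs a f))

  *-distribʳ-sumL : ∀ {X : Set} (xs : List X) (a : Carrier) (f : X → Carrier) → sumL xs f * a ≈ sumL xs (λ x → f x * a)
  *-distribʳ-sumL xs a f =
    trans (*-comm _ a) (trans (*-distribˡ-sumL xs a f) (sumL-cong xs (λ x → *-comm a (f x))))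

  sumL-comm : ∀ {X Y : Set} (xs : List X) (ys : List Y) (f : X → Y → Carrier) →
              sumL xs (λ x → sumL ys (f x)) ≈ sumL ys (λ y → sumL xs (λ x → f x y))
  sumL-comm []       ys f = sym (sumL-zero ys (λ _ → refl))
  sumL-comm (x ∷ xs) ys f =
    trans (+-congˡ (sumL-comm xs ys f)) (sym (sumL-+ ys (f x) (λ y → sumL xs (λ x' → f x' y))))

  sumL-shuffle : ∀ {A B C D : Set} (as : List A) (bs : List B) (cs : List C) (ds : List D) (F : A → B → C → D → Carrier) →
                 sumL as (λ a → sumL bs (λ b → sumL cs (λ c → sumL ds (F a b c))))
                 ≈ sumL cs (λ c → sumL as (λ a → sumL ds (λ d → sumL bs (λ b → F a b c d))))
  sumL-shuffle as bs cs ds F = trans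
    (sumL-cong as (λ a → trans (sumL-comm bs cs _) (sumL-cong cs (λ c → sumL-comm bs ds _))))
    (sumL-comm as cs _)

  sumL-++ : ∀ {X : Set} (xs ys : List X) (f : X → Carrier) → sumL (xs ++ ys) f ≈ sumL xs f + sumL ys f
  sumL-++ []       ys f = sym (+-identityˡ _)
  sumL-++ (x ∷ xs) ys f = trans (+-congˡ (sumL-++ xs ys f)) (sym (+-assoc (f x) _ _))

  sumL-map : ∀ {X Y : Set} (h : X → Y) (xs : List X) (f : Y → Carrier) → sumL (map h xs) f ≡ sumL xs (λ x → f (h x))
  sumL-map h []       f = ≡.refl
  sumL-map h (x ∷ xs) f = ≡.cong (f (h x) +_) (sumL-map h xs f)

  sumL-filter : ∀ {X : Set} (p : X → Bool) (xs : List X) (f : X → Carrier) →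
                sumL (filterᵇ p xs) f ≈ sumL xs (λ x → if p x then f x else 0#)
  sumL-filter p []       f = refl
  sumL-filter p (x ∷ xs) f with p x
  ... | true  = +-congˡ (sumL-filter p xs f)
  ... | false = trans (sumL-filter p xs f) (sym (+-identityˡ _))

  sumL-allFin : ∀ {m} (f : Fin m → Carrier) → sumL (allFin m) f ≡ sum f
  sumL-allFin = go (λ i → i)
    where
    go : ∀ {m} {X : Set} (g : Fin m → X) (f : X → Carrier) → sumL (tabulate g) f ≡ sum (λ i → f (g i))
    go {zero}  g f = ≡.refl
    go {suc m} g f = ≡.cong (f (g Fin.zero) +_) (go (λ i → g (Fin.suc i)) f)

  sumL-allFuns-suc : ∀ {X : Set} k (xs : List X) (F : (Fin (suc k) → X) → Carrier) →
                     sumL (allFuns (suc k) xs) F ≈ sumL xs (λ x → sumL (allFuns k xs) (λ g → F (x ∷ᶠ g)))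
  sumL-allFuns-suc k xs F = trans (sumL-concatMap xs)
    (sumL-cong xs (λ x → reflexive (sumL-map (x ∷ᶠ_) (allFuns k xs) F)))
    where
    sumL-concatMap : ∀ ys → sumL (concatMap (λ x → map (x ∷ᶠ_) (allFuns k xs)) ys) F
                          ≈ sumL ys (λ x → sumL (map (x ∷ᶠ_) (allFuns k xs)) F)
    sumL-concatMap []       = refl
    sumL-concatMap (y ∷ ys) = trans (sumL-++ (map (y ∷ᶠ_) (allFuns k xs)) _ F) (+-congˡ (sumL-concatMap ys))

  sumTo-cong : ∀ N {g h : ℕ → Carrier} → (∀ i → g i ≈ h i) → sumTo N g ≈ sumTo N h
  sumTo-cong zero    g≈h = g≈h 0
  sumTo-cong (suc N) g≈h = +-cong (sumTo-cong N g≈h) (g≈h (suc N))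

  sumTo-zero : ∀ N {g : ℕ → Carrier} → (∀ i → i ℕ.≤ N → g i ≈ 0#) → sumTo N g ≈ 0#
  sumTo-zero zero    g≈0 = g≈0 0 ℕ.z≤n
  sumTo-zero (suc N) g≈0 = trans (+-cong (sumTo-zero N (λ i i≤N → g≈0 i (ℕP.m≤n⇒m≤1+n i≤N))) (g≈0 (suc N) ℕP.≤-refl))
                                 (+-identityˡ 0#)

  sumTo-eq-single : ∀ N (g : ℕ → Carrier) {i₀} → i₀ ℕ.≤ N → (∀ i → i ℕ.≤ N → i ≢ i₀ → g i ≈ 0#) → sumTo N g ≈ g i₀
  sumTo-eq-single zero    g ℕ.z≤n _ = refl
  sumTo-eq-single (suc N) g {i₀} i₀≤1+N g≈0 with i₀ ℕ.≟ suc N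
  ... | yes ≡.refl = trans (+-congʳ (sumTo-zero N (λ i i≤N → g≈0 i (ℕP.m≤n⇒m≤1+n i≤N) (ℕP.<⇒≢ (ℕ.s≤s i≤N)))))
                           (+-identityˡ _)
  ... | no i₀≢1+N  = trans (+-cong (sumTo-eq-single N g (ℕ.s≤s⁻¹ (ℕP.≤∧≢⇒< i₀≤1+N i₀≢1+N))
                                      (λ i i≤N → g≈0 i (ℕP.m≤n⇒m≤1+n i≤N)))
                                   (g≈0 (suc N) ℕP.≤-refl (λ 1+N≡i₀ → i₀≢1+N (≡.sym 1+N≡i₀))))
                           (+-identityʳ _)

  sumTo-sumL : ∀ {X : Set} N (xs : List X) (F : ℕ → X → Carrier) →
               sumTo N (λ i → sumL xs (F i)) ≈ sumL xs (λ y → sumTo N (λ i → F i y))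
  sumTo-sumL zero    xs F = refl
  sumTo-sumL (suc N) xs F = trans (+-congʳ (sumTo-sumL N xs F)) (sym (sumL-+ xs (λ y → sumTo N (λ i → F i y)) (F (suc N))))

  ∷ᶠ-extensional : ∀ {k} {X : Set} {F : (Fin (suc k) → X) → Carrier} → Extensional F → ∀ x →
                   Extensional (λ g → F (x ∷ᶠ g))
  ∷ᶠ-extensional ext x g≗g' = ext (λ { Fin.zero → ≡.refl ; (Fin.suc i) → g≗g' i })

  sumL-allFuns-++ : ∀ {X : Set} a b (xs : List X) (H : (Fin (a ℕ.+ b) → X) → Carrier) → Extensional H →
                    sumL (allFuns (a ℕ.+ b) xs) H ≈ sumL (allFuns a xs) (λ u → sumL (allFuns b xs) (λ w → H (u ++ᶠ w)))
  sumL-allFuns-++ zero    b xs H ext = sym (+-identityʳ _)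
  sumL-allFuns-++ {X} (suc a) b xs H ext = begin
    sumL (allFuns (suc a ℕ.+ b) xs) H
      ≈⟨ sumL-allFuns-suc (a ℕ.+ b) xs H ⟩
    sumL xs (λ x → sumL (allFuns (a ℕ.+ b) xs) (λ g → H (x ∷ᶠ g)))
      ≈⟨ sumL-cong xs (λ x → sumL-allFuns-++ a b xs (λ g → H (x ∷ᶠ g)) (∷ᶠ-extensional ext x)) ⟩
    sumL xs (λ x → sumL (allFuns a xs) (λ u → sumL (allFuns b xs) (λ w → H (x ∷ᶠ (u ++ᶠ w)))))
      ≈⟨ sumL-cong xs (λ x → sumL-cong (allFuns a xs) (λ u → sumL-cong (allFuns b xs) (λ w →
           ext (∷ᶠ-++ᶠ x u w)))) ⟩
    sumL xs (λ x → sumL (allFuns a xs) (λ u → sumL (allFuns b xs) (λ w → H ((x ∷ᶠ u) ++ᶠ w))))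
      ≈⟨ sumL-allFuns-suc a xs (λ u → sumL (allFuns b xs) (λ w → H (u ++ᶠ w))) ⟨
    sumL (allFuns (suc a) xs) (λ u → sumL (allFuns b xs) (λ w → H (u ++ᶠ w))) ∎
    where
    ∷ᶠ-++ᶠ : ∀ x (u : Fin a → X) (w : Fin b → X) i → (x ∷ᶠ (u ++ᶠ w)) i ≡ ((x ∷ᶠ u) ++ᶠ w) i
    ∷ᶠ-++ᶠ x u w Fin.zero    = ≡.refl
    ∷ᶠ-++ᶠ x u w (Fin.suc i) with splitAt a i
    ... | inj₁ _ = ≡.refl
    ... | inj₂ _ = ≡.refl

  sumL-allFuns-unique : ∀ k {n} (φ : (Fin k → Fin n) → Bool) (H : (Fin k → Fin n) → Carrier) (h : Fin k → Fin n) →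
                        (∀ u → φ u ≡ true → ∀ i → u i ≡ h i) → (∀ u → (∀ i → u i ≡ h i) → φ u ≡ true) →
                        Extensional H → sumL (allFuns k (allFin n)) (λ u → if φ u then H u else 0#) ≈ H h
  sumL-allFuns-unique zero φ H h only all ext = trans (+-identityʳ _) (at-empty _)
    where
    at-empty : ∀ u → (if φ u then H u else 0#) ≈ H h
    at-empty u with φ u | all u (λ ())
    ... | true | _ = ext (λ ())
  sumL-allFuns-unique (suc k) {n} φ H h only all ext = begin
    sumL (allFuns (suc k) (allFin n)) (λ u → if φ u then H u else 0#)
      ≈⟨ sumL-allFuns-suc k (allFin n) _ ⟩
    sumL (allFin n) (λ y → sumL (allFuns k (allFin n)) (λ g → if φ (y ∷ᶠ g) then H (y ∷ᶠ g) else 0#))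
      ≡⟨ sumL-allFin {n} _ ⟩
    sum (λ y → sumL (allFuns k (allFin n)) (λ g → if φ (y ∷ᶠ g) then H (y ∷ᶠ g) else 0#))
      ≈⟨ sum-eq-single _ (h Fin.zero) (λ y y≢h₀ → sumL-zero (allFuns k (allFin n)) (λ g → off-graph y g y≢h₀)) ⟩
    sumL (allFuns k (allFin n)) (λ g → if φ (h Fin.zero ∷ᶠ g) then H (h Fin.zero ∷ᶠ g) else 0#)
      ≈⟨ sumL-allFuns-unique k (λ g → φ (h Fin.zero ∷ᶠ g)) (λ g → H (h Fin.zero ∷ᶠ g)) (λ i → h (Fin.suc i))
           (λ u φu i → only _ φu (Fin.suc i))
           (λ u u≗h → all _ (λ { Fin.zero → ≡.refl ; (Fin.suc i) → u≗h i }))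
           (∷ᶠ-extensional ext (h Fin.zero)) ⟩
    H (h Fin.zero ∷ᶠ (λ i → h (Fin.suc i)))
      ≈⟨ ext (λ { Fin.zero → ≡.refl ; (Fin.suc i) → ≡.refl }) ⟩
    H h ∎
    where
    off-graph : ∀ y g → y ≢ h Fin.zero → (if φ (y ∷ᶠ g) then H (y ∷ᶠ g) else 0#) ≈ 0#
    off-graph y g y≢h₀ with φ (y ∷ᶠ g) in φyg
    ... | true  = ⊥-elim (y≢h₀ (only _ φyg Fin.zero))
    ... | false = refl

  sumL-allFuns-fibres :
    ∀ k {X Y Z : Set} (xs : List X) (ys : List Y) (zs : List Z) (match : Y → Z → Bool) (comb : Y → Z → X) →
    (∀ (h : X → Carrier) → sumL xs h ≈ sumL ys (λ y → sumL zs (λ z → if match y z then h (comb y z) else 0#))) →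
    ∀ (G : (Fin k → X) → Carrier) → Extensional G →
    sumL (allFuns k xs) G ≈ sumL (allFuns k ys) (λ f → sumL (allFuns k zs) (λ e →
      if ∀ᵇ (λ r → match (f r) (e r)) then G (λ r → comb (f r) (e r)) else 0#))
  sumL-allFuns-fibres zero xs ys zs match comb fibres G ext =
    trans (+-identityʳ _) (trans (ext (λ ())) (sym (trans (+-identityʳ _) (+-identityʳ _))))
  sumL-allFuns-fibres (suc k) {X} {Y} {Z} xs ys zs match comb fibres G ext = begin
    sumL (allFuns (suc k) xs) G
      ≈⟨ sumL-allFuns-suc k xs G ⟩
    sumL xs (λ x → sumL (allFuns k xs) (λ g → G (x ∷ᶠ g)))
      ≈⟨ sumL-cong xs (λ x → sumL-allFuns-fibres k xs ys zs match comb fibres _ (∷ᶠ-extensional ext x)) ⟩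
    sumL xs (λ x → sumL Fs (λ f → sumL Es (λ e → [ f , e ] G (x ∷ᶠ C f e))))
      ≈⟨ trans (sumL-comm xs Fs _) (sumL-cong Fs (λ f → sumL-comm xs Es _)) ⟩
    sumL Fs (λ f → sumL Es (λ e → sumL xs (λ x → [ f , e ] G (x ∷ᶠ C f e))))
      ≈⟨ sumL-cong Fs (λ f → sumL-cong Es (λ e → fibres _)) ⟩
    sumL Fs (λ f → sumL Es (λ e → sumL ys (λ y → sumL zs (λ z → Term y f z e))))
      ≈⟨ sumL-shuffle Fs Es ys zs (λ f e y z → Term y f z e) ⟩
    sumL ys (λ y → sumL Fs (λ f → sumL zs (λ z → sumL Es (λ e → Term y f z e))))
      ≈⟨ sumL-cong ys (λ y → sumL-cong Fs (λ f →
           trans (sumL-cong zs (λ z → sumL-cong Es (Term-∷ᶠ y f z))) (sym (sumL-allFuns-suc k zs _)))) ⟩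
    sumL ys (λ y → sumL Fs (λ f → sumL (allFuns (suc k) zs) (λ e → [ y ∷ᶠ f , e ] G (C (y ∷ᶠ f) e))))
      ≈⟨ sumL-allFuns-suc k ys _ ⟨
    sumL (allFuns (suc k) ys) (λ f → sumL (allFuns (suc k) zs) (λ e → [ f , e ] G (C f e))) ∎
    where
    Fs : List (Fin k → Y)
    Fs = allFuns k ys
    Es : List (Fin k → Z)
    Es = allFuns k zs
    [_,_]_ : ∀ {j} → (Fin j → Y) → (Fin j → Z) → Carrier → Carrier
    [ f , e ] a = if ∀ᵇ (λ r → match (f r) (e r)) then a else 0#
    C : ∀ {j} → (Fin j → Y) → (Fin j → Z) → Fin j → X
    C f e r = comb (f r) (e r)
    Term : Y → (Fin k → Y) → Z → (Fin k → Z) → Carrier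
    Term y f z e = if match y z then [ f , e ] G (comb y z ∷ᶠ C f e) else 0#
    Term-∷ᶠ : ∀ y f z e → Term y f z e ≈ [ y ∷ᶠ f , z ∷ᶠ e ] G (C (y ∷ᶠ f) (z ∷ᶠ e))
    Term-∷ᶠ y f z e with match y z
    ... | false = refl
    ... | true  = guarded-cong ≡.refl (ext (λ { Fin.zero → ≡.refl ; (Fin.suc i) → ≡.refl }))

module TypeB where
  open import Data.Bool using (Bool; true; false; _∧_; _∨_; not)
  import Data.Bool.Properties as 𝔹
  open import Data.Nat using (_+_)
  open import Data.Fin as Fin using (opposite; _↑ˡ_; _↑ʳ_)
  import Data.Fin.Properties as FinP
  open import Data.Maybe using (Maybe; just; nothing; is-nothing)
  open import Data.Product using (Σ; _×_; _,_; proj₁; proj₂)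
  open import Data.Empty using (⊥-elim)
  open import Data.Sum using (inj₁; inj₂)
  open import Data.Vec.Functional using () renaming (_++_ to _++ᶠ_)
  open import Data.Vec.Functional.Properties using (lookup-++ˡ; lookup-++ʳ)
  open import Function.Definitions using (Injective)
  open import Relation.Binary.PropositionalEquality
  open Counting
  open FinOrder

  isPerm-injective : ∀ {m} (π : Fin m → Fin m) → isPerm π ≡ true → Injective _≡_ _≡_ π
  isPerm-injective π h {i} {j} πi≡πj with allB-true (allB-true h i) j
  ... | cell rewrite πi≡πj | ==-refl (π j) = ==-sound cell

  -- isPerm and isRookConf test their cells with local helpers of Defs, so completeness is
  -- shown by computing a failing cell.
  injective-isPerm : ∀ {m} (π : Fin m → Fin m) → Injective _≡_ _≡_ π → isPerm π ≡ true
  injective-isPerm π inj with isPerm π in eq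
  ... | true  = refl
  ... | false with allB-false eq
  ...   | i , row with allB-false row
  ...     | j , cell with π i == π j in e | i == j in e' | cell
  ...       | false | _     | ()
  ...       | true  | true  | ()
  ...       | true  | false | _ = ⊥-elim (false≢true (trans (sym e')
                                     (subst (λ z → (i == z) ≡ true) (inj (==-sound e)) (==-refl i))))

  isTypeB-sound : ∀ {m} (π : Fin m → Fin m) → isTypeB π ≡ true → ∀ i → π (opposite i) ≡ opposite (π i)
  isTypeB-sound π h i = ==-sound (allB-true h i)

  isTypeB-complete : ∀ {m} (π : Fin m → Fin m) → (∀ i → π (opposite i) ≡ opposite (π i)) → isTypeB π ≡ true
  isTypeB-complete π sym-π = true-allB (λ i → subst (λ z → (π (opposite i) == z) ≡ true) (sym-π i) (==-refl (π (opposite i))))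

  isPerm-cong : ∀ {m} {π π' : Fin m → Fin m} → (∀ i → π i ≡ π' i) → isPerm π ≡ isPerm π'
  isPerm-cong {π = π} {π'} π≗π' = bool-ext
    (λ h → injective-isPerm π' (λ {i} {j} e → isPerm-injective π h (trans (π≗π' i) (trans e (sym (π≗π' j))))))
    (λ h → injective-isPerm π (λ {i} {j} e → isPerm-injective π' h (trans (sym (π≗π' i)) (trans e (π≗π' j)))))

  isTypeB-cong : ∀ {m} {π π' : Fin m → Fin m} → (∀ i → π i ≡ π' i) → isTypeB π ≡ isTypeB π'
  isTypeB-cong {π = π} {π'} π≗π' = trans (allB-∀ᵇ (λ i → π (opposite i) == opposite (π i)))
    (trans (∀ᵇ-cong (λ i → cong₂ _==_ (π≗π' (opposite i)) (cong opposite (π≗π' i))))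
           (sym (allB-∀ᵇ (λ i → π' (opposite i) == opposite (π' i)))))

  inS-cong : ∀ {m} (C : Mat m m) {π π' : Fin m → Fin m} → (∀ i → π i ≡ π' i) → inS C π ≡ inS C π'
  inS-cong C {π} {π'} π≗π' = trans (allB-∀ᵇ (λ i → C i (π i)))
    (trans (∀ᵇ-cong (λ i → cong (C i) (π≗π' i))) (sym (allB-∀ᵇ (λ i → C i (π' i)))))

  ColumnInjective : ∀ {k n} → (Fin k → Maybe (Fin n)) → Set
  ColumnInjective f = ∀ {i i' j} → f i ≡ just j → f i' ≡ just j → i ≡ i'

  record IsRookPlacement {n} (A : Mat n n) (f : Fin n → Maybe (Fin n)) : Set where
    field
      on-ones   : ∀ {i j} → f i ≡ just j → A i j ≡ true
      injective : ColumnInjective f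

  isRookConf-sound : ∀ {n} (A : Mat n n) f → isRookConf A f ≡ true → IsRookPlacement A f
  isRookConf-sound A f h = record { on-ones = on-ones ; injective = injective }
    where
    on-ones : ∀ {i j} → f i ≡ just j → A i j ≡ true
    on-ones {i} {j} fi with f i | fi | allB-true h i
    ... | just .j | refl | row = proj₁ (∧-true row)
    injective : ColumnInjective f
    injective {i} {i'} {j} fi fi' with f i | fi | allB-true h i
    ... | just .j | refl | row with allB-true (proj₂ (∧-true {A i j} row)) i'
    ... | cell with i' == i in e | f i' | fi' | cell
    ...   | true  | _       | _    | _     = sym (==-sound e)
    ...   | false | just .j | refl | cell' = ⊥-elim (not-true cell' (==-refl j))

  isRookConf-complete : ∀ {n} (A : Mat n n) f → IsRookPlacement A f → isRookConf A f ≡ true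
  isRookConf-complete A f rp with isRookConf A f in eq
  ... | true  = refl
  ... | false with allB-false eq
  ...   | i , row with f i in fi | row
  ...     | nothing | ()
  ...     | just j  | row' with ∧-false {A i j} row'
  ...       | inj₁ ¬on = ⊥-elim (false≢true (trans (sym ¬on) (IsRookPlacement.on-ones rp fi)))
  ...       | inj₂ hb with allB-false hb
  ...         | i' , cell with i' == i in e | f i' in fi' | cell
  ...           | true  | _       | ()
  ...           | false | nothing | ()
  ...           | false | just j' | cell' = ⊥-elim (false≢true (trans (sym e)
                    (subst (λ z → (z == i) ≡ true) (IsRookPlacement.injective rp fi (trans fi' (cong just (==-sound (𝔹.not-injective cell')))))
                           (==-refl i))))

  mirror : ∀ {n} → (Fin n → Fin (n + n)) → Fin n → Fin (n + n)
  mirror w r = opposite (w (opposite r))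

  symmetrize : ∀ {n} → (Fin n → Fin (n + n)) → Fin (n + n) → Fin (n + n)
  symmetrize w = mirror w ++ᶠ w

  symmetrize-↑ˡ : ∀ {n} (w : Fin n → Fin (n + n)) r → symmetrize w (r ↑ˡ n) ≡ mirror w r
  symmetrize-↑ˡ w = lookup-++ˡ (mirror w) w

  symmetrize-↑ʳ : ∀ {n} (w : Fin n → Fin (n + n)) s → symmetrize w (n ↑ʳ s) ≡ w s
  symmetrize-↑ʳ w = lookup-++ʳ (mirror w) w

  isTypeB-++ᶠ : ∀ {n} (u w : Fin n → Fin (n + n)) → isTypeB (u ++ᶠ w) ≡ true → ∀ r → u r ≡ mirror w r
  isTypeB-++ᶠ {n} u w h r = begin
    u r                                      ≡⟨ lookup-++ˡ u w r ⟨
    (u ++ᶠ w) (r ↑ˡ n)                       ≡⟨ cong (u ++ᶠ w) r̄ ⟨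
    (u ++ᶠ w) (opposite (n ↑ʳ opposite r))   ≡⟨ isTypeB-sound (u ++ᶠ w) h (n ↑ʳ opposite r) ⟩
    opposite ((u ++ᶠ w) (n ↑ʳ opposite r))   ≡⟨ cong opposite (lookup-++ʳ u w (opposite r)) ⟩
    mirror w r                               ∎
    where
    open ≡-Reasoning
    r̄ : opposite (n ↑ʳ opposite r) ≡ r ↑ˡ n
    r̄ = trans (opposite-↑ʳ n (opposite r)) (cong (_↑ˡ n) (FinP.opposite-involutive r))

  mirror-isTypeB : ∀ {n} (u w : Fin n → Fin (n + n)) → (∀ r → u r ≡ mirror w r) → isTypeB (u ++ᶠ w) ≡ true
  mirror-isTypeB {n} u w u≗w̄ = isTypeB-complete (u ++ᶠ w) at
    where
    at : ∀ x → (u ++ᶠ w) (opposite x) ≡ opposite ((u ++ᶠ w) x)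
    at x with joinView n n x
    ... | left r = begin
      (u ++ᶠ w) (opposite (r ↑ˡ n))   ≡⟨ cong (u ++ᶠ w) (opposite-↑ˡ n r) ⟩
      (u ++ᶠ w) (n ↑ʳ opposite r)     ≡⟨ lookup-++ʳ u w (opposite r) ⟩
      w (opposite r)                  ≡⟨ FinP.opposite-involutive _ ⟨
      opposite (mirror w r)           ≡⟨ cong opposite (trans (lookup-++ˡ u w r) (u≗w̄ r)) ⟨
      opposite ((u ++ᶠ w) (r ↑ˡ n))   ∎
      where open ≡-Reasoning
    ... | right s = begin
      (u ++ᶠ w) (opposite (n ↑ʳ s))   ≡⟨ cong (u ++ᶠ w) (opposite-↑ʳ n s) ⟩
      (u ++ᶠ w) (opposite s ↑ˡ n)     ≡⟨ lookup-++ˡ u w (opposite s) ⟩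
      u (opposite s)                  ≡⟨ u≗w̄ (opposite s) ⟩
      opposite (w (opposite (opposite s))) ≡⟨ cong (λ z → opposite (w z)) (FinP.opposite-involutive s) ⟩
      opposite (w s)                  ≡⟨ cong opposite (lookup-++ʳ u w s) ⟨
      opposite ((u ++ᶠ w) (n ↑ʳ s))   ∎
      where open ≡-Reasoning

  NoOppositePair : ∀ {n} → (Fin n → Fin (n + n)) → Set
  NoOppositePair w = ∀ r s → w s ≢ opposite (w r)

  symmetrize-injective⇒ : ∀ {n} (w : Fin n → Fin (n + n)) → Injective _≡_ _≡_ (symmetrize w) →
                          Injective _≡_ _≡_ w × NoOppositePair w
  symmetrize-injective⇒ {n} w inj =
    (λ {s} {s'} e → FinP.↑ʳ-injective n s s' (inj (trans (symmetrize-↑ʳ w s) (trans e (sym (symmetrize-↑ʳ w s')))))) ,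
    (λ r s e → ↑ˡ≢↑ʳ (opposite r) s (sym (inj (trans (symmetrize-↑ʳ w s) (trans e
       (sym (trans (symmetrize-↑ˡ w (opposite r)) (cong (λ z → opposite (w z)) (FinP.opposite-involutive r)))))))))

  symmetrize-injective⇐ : ∀ {n} (w : Fin n → Fin (n + n)) → Injective _≡_ _≡_ w → NoOppositePair w →
                          Injective _≡_ _≡_ (symmetrize w)
  symmetrize-injective⇐ {n} w inj no-opp {x} {y} e with joinView n n x | joinView n n y
  ... | left r  | left r'  = cong (_↑ˡ n) (opposite-injective (inj (opposite-injective
                               (trans (sym (symmetrize-↑ˡ w r)) (trans e (symmetrize-↑ˡ w r'))))))
  ... | right s | right s' = cong (n ↑ʳ_) (inj (trans (sym (symmetrize-↑ʳ w s)) (trans e (symmetrize-↑ʳ w s'))))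
  ... | left r  | right s  = ⊥-elim (no-opp (opposite r) s
                               (sym (trans (sym (symmetrize-↑ˡ w r)) (trans e (symmetrize-↑ʳ w s)))))
  ... | right s | left r   = ⊥-elim (no-opp (opposite r) s
                               (trans (sym (symmetrize-↑ʳ w s)) (trans e (symmetrize-↑ˡ w r))))

  module _ {n} (B A : Mat n n) where
    #-↑ˡ-↑ˡ : ∀ r c → (B # A) (r ↑ˡ n) (c ↑ˡ n) ≡ B r c
    #-↑ˡ-↑ˡ r c rewrite FinP.splitAt-↑ˡ n r n | FinP.splitAt-↑ˡ n c n = refl

    #-↑ʳ-↑ʳ : ∀ s c → (B # A) (n ↑ʳ s) (n ↑ʳ c) ≡ A s c
    #-↑ʳ-↑ʳ s c rewrite FinP.splitAt-↑ʳ n n s | FinP.splitAt-↑ʳ n n c = refl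

    #-↑ˡ-↑ʳ : ∀ r c → (B # A) (r ↑ˡ n) (n ↑ʳ c) ≡ true
    #-↑ˡ-↑ʳ r c rewrite FinP.splitAt-↑ˡ n r n | FinP.splitAt-↑ʳ n n c = refl

    #-↑ʳ-↑ˡ : ∀ s c → (B # A) (n ↑ʳ s) (c ↑ˡ n) ≡ true
    #-↑ʳ-↑ˡ s c rewrite FinP.splitAt-↑ʳ n n s | FinP.splitAt-↑ˡ n c n = refl

  bottomColumn : ∀ {n} → Maybe (Fin n) → Fin n → Fin (n + n)
  bottomColumn {n} (just c) y = n ↑ʳ c
  bottomColumn {n} nothing  y = y ↑ˡ n

  bottomHalf : ∀ {n} → (Fin n → Maybe (Fin n)) → (Fin n → Fin n) → Fin n → Fin (n + n)
  bottomHalf f e s = bottomColumn (f s) (e s)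

  occupied : ∀ {k n} → (Fin k → Maybe (Fin n)) → Fin n → Bool
  occupied f j = ∃ᵇ (λ i → f i ≡ᵇjust j)

  -- The top half mirrors the bottom half, so a rook in column c of A also fills column
  -- opposite c of the left block; the free rows must avoid those columns.
  available : ∀ {n} → (Fin n → Maybe (Fin n)) → Fin n → Bool
  available f t = not (occupied f (opposite t))

  record FreeInjection {k n} (T : Fin n → Bool) (f : Fin k → Maybe (Fin n)) (e : Fin k → Fin n) : Set where
    field
      into      : ∀ {s} → is-nothing (f s) ≡ true → T (e s) ≡ true
      injective : ∀ {s s'} → is-nothing (f s) ≡ true → is-nothing (f s') ≡ true → e s ≡ e s' → s ≡ s'

  freeInjection? : ∀ {k n} → (Fin n → Bool) → (Fin k → Maybe (Fin n)) → (Fin k → Fin n) → Bool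
  freeInjection? T f e = ∀ᵇ (λ s → not (is-nothing (f s)) ∨ T (e s)) ∧
                         ∀ᵇ (λ s → ∀ᵇ (λ s' → not (is-nothing (f s) ∧ is-nothing (f s') ∧ (e s == e s')) ∨ (s == s')))

  freeInjection?-sound : ∀ {k n} T (f : Fin k → Maybe (Fin n)) e → freeInjection? T f e ≡ true → FreeInjection T f e
  freeInjection?-sound T f e h = record
    { into      = λ {s} free → into-at s free (∀ᵇ-true (proj₁ (∧-true h)) s)
    ; injective = λ {s} {s'} free free' es≡es' →
        injective-at s s' free free' es≡es'
          (∀ᵇ-true (∀ᵇ-true (proj₂ (∧-true {∀ᵇ (λ s → not (is-nothing (f s)) ∨ T (e s))} h)) s) s') }
    where
    into-at : ∀ s → is-nothing (f s) ≡ true → not (is-nothing (f s)) ∨ T (e s) ≡ true → T (e s) ≡ true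
    into-at s free cell rewrite free = cell
    injective-at : ∀ s s' → is-nothing (f s) ≡ true → is-nothing (f s') ≡ true → e s ≡ e s' →
      not (is-nothing (f s) ∧ is-nothing (f s') ∧ (e s == e s')) ∨ (s == s') ≡ true → s ≡ s'
    injective-at s s' free free' es≡es' cell rewrite free | free' | es≡es' | ==-refl (e s') = ==-sound cell

  freeInjection?-complete : ∀ {k n} T (f : Fin k → Maybe (Fin n)) e → FreeInjection T f e → freeInjection? T f e ≡ true
  freeInjection?-complete T f e fi = true-∧ (true-∀ᵇ into-at) (true-∀ᵇ (λ s → true-∀ᵇ (injective-at s)))
    where
    open FreeInjection fi
    into-at : ∀ s → not (is-nothing (f s)) ∨ T (e s) ≡ true
    into-at s with is-nothing (f s) in free
    ... | false = refl
    ... | true  = into free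
    injective-at : ∀ s s' → not (is-nothing (f s) ∧ is-nothing (f s') ∧ (e s == e s')) ∨ (s == s') ≡ true
    injective-at s s' with is-nothing (f s) in free | is-nothing (f s') in free' | e s == e s' in eq
    ... | false | _     | _     = refl
    ... | true  | false | _     = refl
    ... | true  | true  | false = refl
    ... | true  | true  | true  = subst (λ z → (s == z) ≡ true) (injective free free' (==-sound eq)) (==-refl s)

  is-nothing-true : ∀ {n} {m : Maybe (Fin n)} → is-nothing m ≡ true → m ≡ nothing
  is-nothing-true {m = nothing} _ = refl

  occupied-true : ∀ {k n} (f : Fin k → Maybe (Fin n)) {r j} → f r ≡ just j → occupied f j ≡ true
  occupied-true f {r} fr = true-∃ᵇ r (≡ᵇjust-complete fr)

  occupied-witness : ∀ {k n} (f : Fin k → Maybe (Fin n)) {j} → occupied f j ≡ true → Σ (Fin k) (λ r → f r ≡ just j)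
  occupied-witness f h = let (r , p) = ∃ᵇ-true h in r , ≡ᵇjust-sound (f r) p

  -- On a rook row r the value e r is irrelevant; pinning it to the rook's column makes
  -- (f, e) ↦ bottomHalf f e a bijection from consistent pairs onto all bottom halves.
  agrees : ∀ {n} → Maybe (Fin n) → Fin n → Bool
  agrees nothing  y = true
  agrees (just c) y = c == y

  consistent : ∀ {k n} → (Fin k → Maybe (Fin n)) → (Fin k → Fin n) → Bool
  consistent f e = ∀ᵇ (λ r → agrees (f r) (e r))

  module _ {n} (A : Mat n n) (f : Fin n → Maybe (Fin n)) (e : Fin n → Fin n) where
    private
      w : Fin n → Fin (n + n)
      w = bottomHalf f e
      π : Fin (n + n) → Fin (n + n)
      π = symmetrize w
      C : Mat (n + n) (n + n)
      C = rot A # A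

    injective⇒rookPlacement : Injective _≡_ _≡_ π → (∀ x → C x (π x) ≡ true) → IsRookPlacement A f
    injective⇒rookPlacement inj π⊆C = record { on-ones = on-ones ; injective = injective }
      where
      on-ones : ∀ {i j} → f i ≡ just j → A i j ≡ true
      on-ones {i} {j} fi = trans (sym (trans (cong (C (n ↑ʳ i)) (trans (symmetrize-↑ʳ w i)
        (cong (λ m → bottomColumn m (e i)) fi))) (#-↑ʳ-↑ʳ (rot A) A i j))) (π⊆C (n ↑ʳ i))
      injective : ColumnInjective f
      injective {i} {i'} fi fi' = proj₁ (symmetrize-injective⇒ w inj)
        (trans (cong (λ m → bottomColumn m (e i)) fi) (cong (λ m → bottomColumn m (e i')) (sym fi')))

    injective⇒freeInjection : Injective _≡_ _≡_ π → FreeInjection (available f) f e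
    injective⇒freeInjection inj = record { into = into ; injective = injective }
      where
      no-opp : NoOppositePair w
      no-opp = proj₂ (symmetrize-injective⇒ w inj)
      into : ∀ {s} → is-nothing (f s) ≡ true → available f (e s) ≡ true
      into {s} free = true-not λ occ →
        let r , fr = occupied-witness f occ
        in no-opp s r (trans (cong (λ m → bottomColumn m (e r)) fr)
             (sym (trans (cong (λ m → opposite (bottomColumn m (e s))) (is-nothing-true free)) (opposite-↑ˡ n (e s)))))
      injective : ∀ {s s'} → is-nothing (f s) ≡ true → is-nothing (f s') ≡ true → e s ≡ e s' → s ≡ s'
      injective {s} {s'} free free' es≡es' = proj₁ (symmetrize-injective⇒ w inj)
        (trans (cong (λ m → bottomColumn m (e s)) (is-nothing-true free))
        (trans (cong (_↑ˡ n) es≡es') (sym (cong (λ m → bottomColumn m (e s')) (is-nothing-true free')))))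

    rook∧free⇒injective : IsRookPlacement A f → FreeInjection (available f) f e → Injective _≡_ _≡_ π
    rook∧free⇒injective rp fi = symmetrize-injective⇐ w w-inj no-opp
      where
      open FreeInjection fi
      w-inj : Injective _≡_ _≡_ w
      w-inj {s} {s'} eq with f s in fs | f s' in fs'
      ... | just c  | just c'  = IsRookPlacement.injective rp fs (trans fs' (cong just (sym (FinP.↑ʳ-injective n c c' eq))))
      ... | nothing | nothing  = injective (cong is-nothing fs) (cong is-nothing fs') (FinP.↑ˡ-injective n (e s) (e s') eq)
      ... | just c  | nothing  = ⊥-elim (↑ˡ≢↑ʳ (e s') c (sym eq))
      ... | nothing | just c'  = ⊥-elim (↑ˡ≢↑ʳ (e s) c' eq)
      no-opp : NoOppositePair w
      no-opp r s eq with f r in fr | f s in fs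
      ... | just c  | just c'  = ↑ˡ≢↑ʳ (opposite c) c' (sym (trans eq (opposite-↑ʳ n c)))
      ... | nothing | nothing  = ↑ˡ≢↑ʳ (e s) (opposite (e r)) (trans eq (opposite-↑ˡ n (e r)))
      ... | just c  | nothing  = not-true (into (cong is-nothing fs)) (occupied-true f (trans fr (cong just
          (sym (trans (cong opposite (FinP.↑ˡ-injective n (e s) (opposite c) (trans eq (opposite-↑ʳ n c))))
                      (FinP.opposite-involutive c))))))
      ... | nothing | just c'  = not-true (into (cong is-nothing fr)) (occupied-true f (trans fs (cong just
          (FinP.↑ʳ-injective n c' (opposite (e r)) (trans eq (opposite-↑ˡ n (e r)))))))

    rook⇒inS : IsRookPlacement A f → ∀ x → C x (π x) ≡ true
    rook⇒inS rp x with joinView n n x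
    ... | right s = subst (λ z → C (n ↑ʳ s) z ≡ true) (sym (symmetrize-↑ʳ w s)) (bottom (f s) refl)
      where
      bottom : ∀ m → f s ≡ m → C (n ↑ʳ s) (bottomColumn m (e s)) ≡ true
      bottom (just c) fs = trans (#-↑ʳ-↑ʳ (rot A) A s c) (IsRookPlacement.on-ones rp fs)
      bottom nothing  fs = #-↑ʳ-↑ˡ (rot A) A s (e s)
    ... | left r = subst (λ z → C (r ↑ˡ n) z ≡ true) (sym (symmetrize-↑ˡ w r)) (top (f (opposite r)) refl)
      where
      top : ∀ m → f (opposite r) ≡ m → C (r ↑ˡ n) (opposite (bottomColumn m (e (opposite r)))) ≡ true
      top (just c) fs = trans (cong (C (r ↑ˡ n)) (opposite-↑ʳ n c)) (trans (#-↑ˡ-↑ˡ (rot A) A r (opposite c))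
          (trans (cong (A (opposite r)) (FinP.opposite-involutive c)) (IsRookPlacement.on-ones rp fs)))
      top nothing  fs = trans (cong (C (r ↑ˡ n)) (opposite-↑ˡ n (e (opposite r)))) (#-↑ˡ-↑ʳ (rot A) A r _)

    isPerm∧inS≡isRookConf∧freeInjection? :
      (isPerm π ∧ inS C π) ≡ (isRookConf A f ∧ freeInjection? (available f) f e)
    isPerm∧inS≡isRookConf∧freeInjection? = bool-ext
      (λ h → let perm , inS = ∧-true {isPerm π} h
                 inj = isPerm-injective π perm
             in true-∧ (isRookConf-complete A f (injective⇒rookPlacement inj (allB-true inS)))
                       (freeInjection?-complete (available f) f e (injective⇒freeInjection inj)))
      (λ h → let rook , free = ∧-true {isRookConf A f} h
                 rp = isRookConf-sound A f rook
             in true-∧ (injective-isPerm π (rook∧free⇒injective rp (freeInjection?-sound (available f) f e free)))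
                       (true-allB (rook⇒inS rp)))

module Statistics where
  open import Data.Bool using (Bool; true; false; _∧_; _∨_; not)
  import Data.Bool.Properties as 𝔹
  open import Data.Nat as ℕ using (zero; suc; _+_; _*_; _<ᵇ_; s≤s)
  import Data.Nat.Properties as ℕP
  open import Data.Nat.Tactic.RingSolver using (solve-∀)
  open import Data.Fin as Fin using (toℕ; opposite; _↑ˡ_; _↑ʳ_)
  import Data.Fin.Properties as FinP
  open import Data.Maybe using (Maybe; just; nothing; is-just; is-nothing; maybe′)
  open import Data.Maybe.Properties using (just-injective)
  open import Data.Product using (Σ; _,_; proj₁; proj₂)
  open import Data.Empty using (⊥-elim)
  open import Data.Vec.Functional using () renaming (_∷_ to _∷ᶠ_)
  open import Relation.Binary.PropositionalEquality
  open Counting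
  open FinOrder
  open TypeB

  #free : ∀ {k n} → (Fin k → Maybe (Fin n)) → ℕ
  #free f = # (λ i → is-nothing (f i))

  inv-cong : ∀ {m} {π π' : Fin m → Fin m} → (∀ i → π i ≡ π' i) → inv π ≡ inv π'
  inv-cong {π = π} {π'} π≗π' = trans (count2-∑# (λ i j → (i <F j) ∧ (π j <F π i)))
    (trans (ℕ∑.sum-cong-≗ (λ i → #-cong (λ j → cong ((i <F j) ∧_) (cong₂ _<F_ (π≗π' j) (π≗π' i)))))
           (sym (count2-∑# (λ i j → (i <F j) ∧ (π' j <F π' i)))))

  neg-cong : ∀ n {π π' : Fin (n + n) → Fin (n + n)} → (∀ i → π i ≡ π' i) → neg n π ≡ neg n π'
  neg-cong n {π} {π'} π≗π' = trans (count-# (λ i → (n <ᵇ suc (toℕ i)) ∧ (toℕ (π i) <ᵇ n)))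
    (trans (#-cong (λ i → cong (λ z → (n <ᵇ suc (toℕ i)) ∧ (toℕ z <ᵇ n)) (π≗π' i)))
           (sym (count-# (λ i → (n <ᵇ suc (toℕ i)) ∧ (toℕ (π' i) <ᵇ n)))))

  rowClear : ∀ {n} → Maybe (Fin n) → Fin n → Bool
  rowClear nothing  j = true
  rowClear (just k) j = k <F j

  occupiedFrom : ∀ {n} → (Fin n → Maybe (Fin n)) → Fin n → Fin n → Bool
  occupiedFrom f i j = ∃ᵇ (λ i' → not (i' <F i) ∧ (f i' ≡ᵇjust j))

  occupiedBefore : ∀ {n} → (Fin n → Maybe (Fin n)) → Fin n → Fin n → Bool
  occupiedBefore f i j = ∃ᵇ (λ i' → (i' <F i) ∧ (f i' ≡ᵇjust j))

  -- `rooks` and `invA` are written with local helpers in Defs; unification recovers their bodies.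
  private
    rooks-body : ∀ {n} (f : Fin n → Maybe (Fin n)) → Σ (Fin n → Bool) (λ p → rooks f ≡ count p)
    rooks-body f = _ , refl

    invA-body : ∀ {n} (f : Fin n → Maybe (Fin n)) →
      Σ (Fin n → Fin n → Bool) (λ r → Σ (Fin n → Fin n → Fin n → Bool) (λ c →
        invA f ≡ count2 (λ i j → r i j ∧ allB (c i j))))
    invA-body f = _ , _ , refl

  rooks-# : ∀ {n} (f : Fin n → Maybe (Fin n)) → rooks f ≡ # (λ i → is-just (f i))
  rooks-# f = trans (proj₂ (rooks-body f)) (trans (count-# (proj₁ (rooks-body f))) (#-cong at))
    where
    at : ∀ i → proj₁ (rooks-body f) i ≡ is-just (f i)
    at i with f i
    ... | nothing = refl
    ... | just _  = refl

  invA-cells : ∀ {n} (f : Fin n → Maybe (Fin n)) →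
               invA f ≡ ℕ∑.sum (λ i → # (λ j → rowClear (f i) j ∧ not (occupiedFrom f i j)))
  invA-cells f = trans (proj₂ (proj₂ (invA-body f)))
    (trans (count2-∑# (λ i j → proj₁ (invA-body f) i j ∧ allB (proj₁ (proj₂ (invA-body f)) i j)))
           (ℕ∑.sum-cong-≗ (λ i → #-cong (λ j → cong₂ _∧_ (row i j) (cells i j)))))
    where
    row : ∀ i j → proj₁ (invA-body f) i j ≡ rowClear (f i) j
    row i j with f i
    ... | nothing = refl
    ... | just _  = refl
    col : ∀ i j i' → proj₁ (proj₂ (invA-body f)) i j i' ≡ ((i' <F i) ∨ not (f i' ≡ᵇjust j))
    col i j i' with i' <F i | f i'
    ... | true  | _       = refl
    ... | false | nothing = refl
    ... | false | just _  = refl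
    cells : ∀ i j → allB (proj₁ (proj₂ (invA-body f)) i j) ≡ not (occupiedFrom f i j)
    cells i j = trans (allB-∀ᵇ (proj₁ (proj₂ (invA-body f)) i j))
                      (trans (∀ᵇ-cong (col i j)) (∀ᵇ-∨-not (_<F i) (λ i' → f i' ≡ᵇjust j)))

  #rooks+#free : ∀ {n} (f : Fin n → Maybe (Fin n)) → # (λ i → is-just (f i)) + #free f ≡ n
  #rooks+#free f = #-+-#-not (λ i → is-just (f i))

  #-∧-true : ∀ {m} (p : Fin m → Bool) → # (λ i → p i ∧ true) ≡ # p
  #-∧-true p = #-cong (λ i → 𝔹.∧-identityʳ (p i))

  #occupied : ∀ {k n} (f : Fin k → Maybe (Fin n)) → ColumnInjective f → # (occupied f) ≡ # (λ i → is-just (f i))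
  #occupied f inj = begin
    # (occupied f)                                ≡⟨ #-∧-true (occupied f) ⟨
    # (λ j → occupied f j ∧ true)                 ≡⟨ #-image (λ _ → true) f (λ _ → true) (λ _ _ → inj) ⟩
    # (λ i → maybe′ (λ _ → true) false (f i))     ≡⟨ #-cong (λ i → maybe-is-just (f i)) ⟩
    # (λ i → is-just (f i))                       ∎
    where
    open ≡-Reasoning
    maybe-is-just : ∀ {n} (m : Maybe (Fin n)) → maybe′ (λ _ → true) false m ≡ is-just m
    maybe-is-just nothing  = refl
    maybe-is-just (just _) = refl

  #unoccupied : ∀ {n} (f : Fin n → Maybe (Fin n)) → ColumnInjective f →
                # (λ j → not (occupied f j)) ≡ #free f
  #unoccupied {n} f inj = ℕP.+-cancelˡ-≡ (# (occupied f)) _ _ (begin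
    # (occupied f) + # (λ j → not (occupied f j))          ≡⟨ #-+-#-not (occupied f) ⟩
    n                                                      ≡⟨ #rooks+#free f ⟨
    # (λ i → is-just (f i)) + #free f                      ≡⟨ cong (_+ #free f) (#occupied f inj) ⟨
    # (occupied f) + #free f                               ∎)
    where open ≡-Reasoning

  #available : ∀ {n} (f : Fin n → Maybe (Fin n)) → ColumnInjective f → # (available f) ≡ #free f
  #available f inj = trans (ℕ∑.sum-opposite (λ j → χ (not (occupied f j)))) (#unoccupied f inj)

  freeInjection-onto : ∀ {k n} (T : Fin n → Bool) (f : Fin k → Maybe (Fin n)) (e : Fin k → Fin n) →
                       FreeInjection T f e → # T ≡ #free f →
                       ∀ t → T t ≡ ∃ᵇ (λ s → is-nothing (f s) ∧ (e s == t))
  freeInjection-onto T f e fi #T≡#free t = bool-ext (#-≡⇒⊇ image⊆T #image≡#T t) (image⊆T t)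
    where
    open FreeInjection fi
    image : _ → Bool
    image t = ∃ᵇ (λ s → is-nothing (f s) ∧ (e s == t))
    image⊆T : ∀ t → image t ≡ true → T t ≡ true
    image⊆T t h = let s , hs = ∃ᵇ-true h
                      free , es≡t = ∧-true {is-nothing (f s)} hs
                  in subst (λ z → T z ≡ true) (==-sound es≡t) (into free)
    #image≡#T : # image ≡ # T
    #image≡#T = begin
      # image                                    ≡⟨ #-∧-true image ⟨
      # (λ t → image t ∧ true)                   ≡⟨ #-image (λ s → is-nothing (f s)) (λ s → just (e s)) (λ _ → true)
                                                      (λ p p' e₁ e₂ → injective p p' (just-injective (trans e₁ (sym e₂)))) ⟩
      # (λ s → is-nothing (f s) ∧ true)          ≡⟨ #-∧-true (λ s → is-nothing (f s)) ⟩
      #free f                                    ≡⟨ #T≡#free ⟨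
      # T                                        ∎
      where open ≡-Reasoning

  -- Φ (f s) (f r) [r < s] (e r) is the number of cells of row s that row r accounts for in inv_A.
  Φ : ∀ {n} → Maybe (Fin n) → Maybe (Fin n) → Bool → Fin n → ℕ
  Φ nothing  nothing   _   _  = 1
  Φ nothing  (just _)  r<s _  = χ r<s
  Φ (just c) nothing   _   eʳ = χ (c <F opposite eʳ)
  Φ (just c) (just c') r<s _  = χ (r<s ∧ (c <F c'))

  module _ {n} (f : Fin n → Maybe (Fin n)) (e : Fin n → Fin n)
           (inj : ColumnInjective f) (fi : FreeInjection (available f) f e) where

    row-split : ∀ s → # (λ j → rowClear (f s) j ∧ not (occupiedFrom f s j))
                    ≡ # (λ j → not (occupied f j) ∧ rowClear (f s) j)
                      + # (λ r → (r <F s) ∧ maybe′ (rowClear (f s)) false (f r))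
    row-split s = begin
      # (λ j → R j ∧ not (occupiedFrom f s j))
        ≡⟨ ℕ∑.sum-cong-≗ (λ j → χ-split (R j) (occupiedBefore f s j) (occupiedFrom f s j) (disjoint j)) ⟩
      ℕ∑.sum (λ j → χ (not (occupiedBefore f s j ∨ occupiedFrom f s j) ∧ R j) + χ (occupiedBefore f s j ∧ R j))
        ≡⟨ ℕ∑.∑-distrib-+ (λ j → χ (not (occupiedBefore f s j ∨ occupiedFrom f s j) ∧ R j)) _ ⟩
      # (λ j → not (occupiedBefore f s j ∨ occupiedFrom f s j) ∧ R j) + # (λ j → occupiedBefore f s j ∧ R j)
        ≡⟨ cong₂ _+_ (#-cong (λ j → cong (λ b → not b ∧ R j) (sym (∃ᵇ-split (_<F s) (λ i → f i ≡ᵇjust j)))))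
                     (#-image (_<F s) f R (λ _ _ → inj)) ⟩
      # (λ j → not (occupied f j) ∧ R j) + # (λ r → (r <F s) ∧ maybe′ R false (f r)) ∎
      where
      open ≡-Reasoning
      R : Fin n → Bool
      R = rowClear (f s)
      χ-split : ∀ r b a → b ∧ a ≡ false → χ (r ∧ not a) ≡ χ (not (b ∨ a) ∧ r) + χ (b ∧ r)
      χ-split true  true  false _ = refl
      χ-split true  false true  _ = refl
      χ-split true  false false _ = refl
      χ-split false true  false _ = refl
      χ-split false false true  _ = refl
      χ-split false false false _ = refl
      disjoint : ∀ j → occupiedBefore f s j ∧ occupiedFrom f s j ≡ false
      disjoint j = 𝔹.¬-not λ both →
        let before , from = ∧-true {occupiedBefore f s j} both
            i , hi = ∃ᵇ-true before
            i' , hi' = ∃ᵇ-true from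
            i<s , fi = ∧-true {i <F s} hi
            i'≮s , fi' = ∧-true {not (i' <F s)} hi'
        in not-true i'≮s (subst (λ z → (z <F s) ≡ true)
             (inj (≡ᵇjust-sound (f i) fi) (≡ᵇjust-sound (f i') fi')) i<s)

    unoccupied-right-of : ∀ c → # (λ j → not (occupied f j) ∧ (c <F j))
                              ≡ # (λ r → is-nothing (f r) ∧ (c <F opposite (e r)))
    unoccupied-right-of c = begin
      # (λ j → not (occupied f j) ∧ (c <F j))          ≡⟨ ℕ∑.sum-opposite (λ j → χ (not (occupied f j) ∧ (c <F j))) ⟨
      # (λ t → available f t ∧ (c <F opposite t))      ≡⟨ #-cong (λ t → cong (_∧ (c <F opposite t)) (onto t)) ⟩
      # (λ t → ∃ᵇ (λ r → is-nothing (f r) ∧ (e r == t)) ∧ (c <F opposite t))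
                                                       ≡⟨ #-image (λ r → is-nothing (f r)) (λ r → just (e r)) (λ t → c <F opposite t)
                                                            (λ p p' e₁ e₂ → FreeInjection.injective fi p p' (just-injective (trans e₁ (sym e₂)))) ⟩
      # (λ r → is-nothing (f r) ∧ (c <F opposite (e r))) ∎
      where
      open ≡-Reasoning
      onto : ∀ t → available f t ≡ ∃ᵇ (λ r → is-nothing (f r) ∧ (e r == t))
      onto = freeInjection-onto (available f) f e fi (#available f inj)

    row-cells : ∀ s → # (λ j → rowClear (f s) j ∧ not (occupiedFrom f s j)) ≡ ℕ∑.sum (λ r → Φ (f s) (f r) (r <F s) (e r))
    row-cells s = trans (row-split s) (by-row-kind (f s))
      where
      open ≡-Reasoning
      free-row : ∀ m r<s eʳ → χ (is-nothing m) + χ (r<s ∧ maybe′ (λ _ → true) false m) ≡ Φ nothing m r<s eʳ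
      free-row nothing  r<s   _ = cong (λ b → suc (χ b)) (𝔹.∧-zeroʳ r<s)
      free-row (just _) true  _ = refl
      free-row (just _) false _ = refl
      rook-row : ∀ c m r<s eʳ → χ (is-nothing m ∧ (c <F opposite eʳ)) + χ (r<s ∧ maybe′ (c <F_) false m) ≡ Φ (just c) m r<s eʳ
      rook-row c nothing  r<s eʳ = trans (cong (χ (c <F opposite eʳ) +_) (cong χ (𝔹.∧-zeroʳ r<s))) (ℕP.+-identityʳ _)
      rook-row c (just _) r<s eʳ = refl
      by-row-kind : ∀ m → # (λ j → not (occupied f j) ∧ rowClear m j) + # (λ r → (r <F s) ∧ maybe′ (rowClear m) false (f r))
                        ≡ ℕ∑.sum (λ r → Φ m (f r) (r <F s) (e r))
      by-row-kind nothing = begin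
        # (λ j → not (occupied f j) ∧ true) + # (λ r → (r <F s) ∧ maybe′ (λ _ → true) false (f r))
          ≡⟨ cong (_+ # (λ r → (r <F s) ∧ maybe′ (λ _ → true) false (f r)))
                  (trans (#-∧-true (λ j → not (occupied f j))) (#unoccupied f inj)) ⟩
        #free f + # (λ r → (r <F s) ∧ maybe′ (λ _ → true) false (f r))
          ≡⟨ ℕ∑.∑-distrib-+ (λ r → χ (is-nothing (f r))) (λ r → χ ((r <F s) ∧ maybe′ (λ _ → true) false (f r))) ⟨
        ℕ∑.sum (λ r → χ (is-nothing (f r)) + χ ((r <F s) ∧ maybe′ (λ _ → true) false (f r)))
          ≡⟨ ℕ∑.sum-cong-≗ (λ r → free-row (f r) (r <F s) (e r)) ⟩
        ℕ∑.sum (λ r → Φ nothing (f r) (r <F s) (e r)) ∎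
      by-row-kind (just c) = begin
        # (λ j → not (occupied f j) ∧ (c <F j)) + # (λ r → (r <F s) ∧ maybe′ (c <F_) false (f r))
          ≡⟨ cong (_+ # (λ r → (r <F s) ∧ maybe′ (c <F_) false (f r))) (unoccupied-right-of c) ⟩
        # (λ r → is-nothing (f r) ∧ (c <F opposite (e r))) + # (λ r → (r <F s) ∧ maybe′ (c <F_) false (f r))
          ≡⟨ ℕ∑.∑-distrib-+ (λ r → χ (is-nothing (f r) ∧ (c <F opposite (e r))))
                            (λ r → χ ((r <F s) ∧ maybe′ (c <F_) false (f r))) ⟨
        ℕ∑.sum (λ r → χ (is-nothing (f r) ∧ (c <F opposite (e r))) + χ ((r <F s) ∧ maybe′ (c <F_) false (f r)))
          ≡⟨ ℕ∑.sum-cong-≗ (λ r → rook-row c (f r) (r <F s) (e r)) ⟩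
        ℕ∑.sum (λ r → Φ (just c) (f r) (r <F s) (e r)) ∎

  Σ² : ∀ {m k} → (Fin m → Fin k → ℕ) → ℕ
  Σ² h = ℕ∑.sum (λ r → ℕ∑.sum (h r))

  Σ²-cong : ∀ {m k} {h g : Fin m → Fin k → ℕ} → (∀ r s → h r s ≡ g r s) → Σ² h ≡ Σ² g
  Σ²-cong h≗g = ℕ∑.sum-cong-≗ (λ r → ℕ∑.sum-cong-≗ (h≗g r))

  Σ²-zero : ∀ {m k} → Σ² {m} {k} (λ _ _ → 0) ≡ 0
  Σ²-zero {m} {k} = trans (ℕ∑.sum-cong-≗ {m} {λ _ → ℕ∑.sum {k} (λ _ → 0)} {λ _ → 0} (λ _ → ℕ∑.sum-replicate-zero k))
                          (ℕ∑.sum-replicate-zero m)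

  Σ²-+ : ∀ {m k} (h g : Fin m → Fin k → ℕ) → Σ² (λ r s → h r s + g r s) ≡ Σ² h + Σ² g
  Σ²-+ h g = trans (ℕ∑.sum-cong-≗ (λ r → ℕ∑.∑-distrib-+ (h r) (g r))) (ℕ∑.∑-distrib-+ (λ r → ℕ∑.sum (h r)) _)

  Σ²-*ˡ : ∀ {m k} c (h : Fin m → Fin k → ℕ) → Σ² (λ r s → c * h r s) ≡ c * Σ² h
  Σ²-*ˡ c h = sym (trans (ℕ∑.*-distribˡ-sum c (λ r → ℕ∑.sum (h r)))
                         (ℕ∑.sum-cong-≗ (λ r → ℕ∑.*-distribˡ-sum c (h r))))

  Σ²-transpose : ∀ {m k} (h : Fin m → Fin k → ℕ) → Σ² h ≡ Σ² (λ s r → h r s)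
  Σ²-transpose = ℕ∑.∑-comm

  Σ²-opposite : ∀ {m k} (h : Fin m → Fin k → ℕ) → Σ² (λ r s → h (opposite r) (opposite s)) ≡ Σ² h
  Σ²-opposite h = trans (ℕ∑.sum-cong-≗ (λ r → ℕ∑.sum-opposite (h (opposite r)))) (ℕ∑.sum-opposite (λ r → ℕ∑.sum (h r)))

  #*# : ∀ {m k} (p : Fin m → Bool) (q : Fin k → Bool) → # p * # q ≡ Σ² (λ r s → χ (p r ∧ q s))
  #*# p q = trans (ℕ∑.*-distribʳ-sum (# q) (λ r → χ (p r)))
    (ℕ∑.sum-cong-≗ (λ r → trans (ℕ∑.*-distribˡ-sum (χ (p r)) (λ s → χ (q s))) (ℕ∑.sum-cong-≗ (λ s → χ-∧ (p r) (q s)))))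
    where
    χ-∧ : ∀ a b → χ a * χ b ≡ χ (a ∧ b)
    χ-∧ true  true  = refl
    χ-∧ true  false = refl
    χ-∧ false _     = refl

  Σ²-quadrants : ∀ a b (h : Fin (a + b) → Fin (a + b) → ℕ) →
    Σ² h ≡ (Σ² (λ r r' → h (r ↑ˡ b) (r' ↑ˡ b)) + Σ² (λ r s → h (r ↑ˡ b) (a ↑ʳ s)))
         + (Σ² (λ s r → h (a ↑ʳ s) (r ↑ˡ b)) + Σ² (λ s s' → h (a ↑ʳ s) (a ↑ʳ s')))
  Σ²-quadrants a b h = trans (ℕ∑.sum-↑ a b (λ x → ℕ∑.sum (h x))) (cong₂ _+_ (rows (λ r → r ↑ˡ b)) (rows (a ↑ʳ_)))
    where
    rows : ∀ {k} (g : Fin k → Fin (a + b)) →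
           ℕ∑.sum (λ r → ℕ∑.sum (h (g r))) ≡ Σ² (λ r r' → h (g r) (r' ↑ˡ b)) + Σ² (λ r s → h (g r) (a ↑ʳ s))
    rows g = trans (ℕ∑.sum-cong-≗ (λ r → ℕ∑.sum-↑ a b (h (g r)))) (ℕ∑.∑-distrib-+ (λ r → ℕ∑.sum (λ r' → h (g r) (r' ↑ˡ b))) _)

  inversionsᵇ : ∀ {n} → (Fin n → Fin (n + n)) → ℕ
  inversionsᵇ w = Σ² (λ r s → χ ((r <F s) ∧ (w s <F w r)))

  inv-symmetrize : ∀ {n} (w : Fin n → Fin (n + n)) →
    inv (symmetrize w) ≡ (inversionsᵇ w + Σ² (λ r s → χ (w s <F opposite (w r)))) + (0 + inversionsᵇ w)
  inv-symmetrize {n} w = trans (count2-∑# (λ x y → (x <F y) ∧ (π y <F π x)))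
    (trans (Σ²-quadrants n n I) (cong₂ _+_ (cong₂ _+_ top-top top-bottom) (cong₂ _+_ bottom-top bottom-bottom)))
    where
    π : Fin (n + n) → Fin (n + n)
    π = symmetrize w
    I : Fin (n + n) → Fin (n + n) → ℕ
    I x y = χ ((x <F y) ∧ (π y <F π x))
    top-top : Σ² (λ r r' → I (r ↑ˡ n) (r' ↑ˡ n)) ≡ inversionsᵇ w
    top-top = begin
      Σ² (λ r r' → I (r ↑ˡ n) (r' ↑ˡ n))
        ≡⟨ Σ²-cong (λ r r' → cong χ (cong₂ _∧_ (trans (↑ˡ-<F-↑ˡ n r r') (sym (opposite-<F r' r)))
             (trans (cong₂ _<F_ (symmetrize-↑ˡ w r') (symmetrize-↑ˡ w r)) (opposite-<F (w (opposite r')) (w (opposite r)))))) ⟩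
      Σ² (λ r r' → χ ((opposite r' <F opposite r) ∧ (w (opposite r) <F w (opposite r'))))
        ≡⟨ Σ²-opposite (λ r r' → χ ((r' <F r) ∧ (w r <F w r'))) ⟩
      Σ² (λ r r' → χ ((r' <F r) ∧ (w r <F w r')))
        ≡⟨ Σ²-transpose (λ r s → χ ((r <F s) ∧ (w s <F w r))) ⟨
      inversionsᵇ w ∎
      where open ≡-Reasoning
    top-bottom : Σ² (λ r s → I (r ↑ˡ n) (n ↑ʳ s)) ≡ Σ² (λ r s → χ (w s <F opposite (w r)))
    top-bottom = trans (Σ²-cong (λ r s → cong χ (trans (cong (_∧ (π (n ↑ʳ s) <F π (r ↑ˡ n))) (↑ˡ-<F-↑ʳ r s))
        (cong₂ _<F_ (symmetrize-↑ʳ w s) (symmetrize-↑ˡ w r)))))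
      (ℕ∑.sum-opposite (λ r → ℕ∑.sum (λ s → χ (w s <F opposite (w r)))))
    bottom-top : Σ² (λ s r → I (n ↑ʳ s) (r ↑ˡ n)) ≡ 0
    bottom-top = trans (Σ²-cong (λ s r → cong (λ b → χ (b ∧ (π (r ↑ˡ n) <F π (n ↑ʳ s)))) (↑ʳ-<F-↑ˡ s r)))
      (Σ²-zero {n} {n})
    bottom-bottom : Σ² (λ s s' → I (n ↑ʳ s) (n ↑ʳ s')) ≡ inversionsᵇ w
    bottom-bottom = Σ²-cong (λ s s' → cong χ (cong₂ _∧_ (↑ʳ-<F-↑ʳ n s s')
      (cong₂ _<F_ (symmetrize-↑ʳ w s') (symmetrize-↑ʳ w s))))

  invFree : ∀ {k n} → (Fin k → Maybe (Fin n)) → (Fin k → Fin n) → ℕ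
  invFree f e = Σ² (λ r s → χ (is-nothing (f r) ∧ is-nothing (f s) ∧ (r <F s) ∧ (e s <F e r)))

  pair-identity : ∀ {n} (m₁ m₂ : Maybe (Fin n)) (e₁ e₂ : Fin n) (r<s : Bool) →
    let b₁ = bottomColumn m₁ e₁
        b₂ = bottomColumn m₂ e₂
    in χ (r<s ∧ (b₂ <F b₁)) + χ (r<s ∧ (b₂ <F b₁))
       + χ (is-nothing m₁ ∧ (b₂ <F opposite b₁)) + χ (is-just m₂ ∧ (b₂ <F opposite b₁))
       + χ (is-nothing m₁ ∧ is-nothing m₂)
       ≡ 2 * Φ m₂ m₁ r<s e₁ + 2 * χ (is-nothing m₁ ∧ is-nothing m₂ ∧ r<s ∧ (e₂ <F e₁))
  pair-identity {n} nothing nothing e₁ e₂ r<s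
    rewrite ↑ˡ-<F-↑ˡ n e₂ e₁ | opposite-↑ˡ n e₁ | ↑ˡ-<F-↑ʳ e₂ (opposite e₁) = both-free (χ (r<s ∧ (e₂ <F e₁)))
    where
    both-free : ∀ x → x + x + 1 + 0 + 1 ≡ 2 * 1 + 2 * x
    both-free = solve-∀
  pair-identity {n} (just c) (just c') e₁ e₂ r<s
    rewrite ↑ʳ-<F-↑ʳ n c' c | opposite-↑ʳ n c | ↑ʳ-<F-↑ˡ c' (opposite c) = no-free (χ (r<s ∧ (c' <F c)))
    where
    no-free : ∀ x → x + x + 0 + 0 + 0 ≡ 2 * x + 2 * 0
    no-free = solve-∀
  pair-identity {n} (just c) nothing e₁ e₂ r<s
    rewrite ↑ˡ-<F-↑ʳ e₂ c | 𝔹.∧-identityʳ r<s = no-free (χ r<s)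
    where
    no-free : ∀ x → x + x + 0 + 0 + 0 ≡ 2 * x + 2 * 0
    no-free = solve-∀
  pair-identity {n} nothing (just c) e₁ e₂ r<s
    rewrite ↑ʳ-<F-↑ˡ c e₁ | 𝔹.∧-zeroʳ r<s | opposite-↑ˡ n e₁ | ↑ʳ-<F-↑ʳ n c (opposite e₁) = mirrored (χ (c <F opposite e₁))
    where
    mirrored : ∀ y → 0 + 0 + y + y + 0 ≡ 2 * y + 2 * 0
    mirrored = solve-∀

  module _ {n} (f : Fin n → Maybe (Fin n)) (e : Fin n → Fin n) where
    private
      w : Fin n → Fin (n + n)
      w = bottomHalf f e

    top-bottom-split : Σ² (λ r s → χ (w s <F opposite (w r)))
                       ≡ Σ² (λ r s → χ (is-nothing (f r) ∧ (w s <F opposite (w r))))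
                         + Σ² (λ r s → χ (is-just (f s) ∧ (w s <F opposite (w r))))
    top-bottom-split = begin
      Σ² (λ r s → χ (w s <F opposite (w r)))
        ≡⟨ Σ²-cong (λ r s → by-kind (f r) (w s <F opposite (w r))) ⟩
      Σ² (λ r s → χ (is-nothing (f r) ∧ (w s <F opposite (w r))) + χ (is-just (f r) ∧ (w s <F opposite (w r))))
        ≡⟨ Σ²-+ (λ r s → χ (is-nothing (f r) ∧ (w s <F opposite (w r)))) _ ⟩
      Σ² (λ r s → χ (is-nothing (f r) ∧ (w s <F opposite (w r))))
        + Σ² (λ r s → χ (is-just (f r) ∧ (w s <F opposite (w r))))
        ≡⟨ cong (Σ² (λ r s → χ (is-nothing (f r) ∧ (w s <F opposite (w r)))) +_)
                (trans (Σ²-transpose (λ r s → χ (is-just (f r) ∧ (w s <F opposite (w r)))))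
                       (Σ²-cong (λ r s → cong (λ b → χ (is-just (f s) ∧ b)) (<F-opposite-comm (w s) (w r))))) ⟩
      Σ² (λ r s → χ (is-nothing (f r) ∧ (w s <F opposite (w r))))
        + Σ² (λ r s → χ (is-just (f s) ∧ (w s <F opposite (w r)))) ∎
      where
      open ≡-Reasoning
      by-kind : ∀ (m : Maybe (Fin n)) x → χ x ≡ χ (is-nothing m ∧ x) + χ (is-just m ∧ x)
      by-kind nothing  x = sym (ℕP.+-identityʳ _)
      by-kind (just _) x = refl

    invA-Φ : ColumnInjective f → FreeInjection (available f) f e →
             invA f ≡ Σ² (λ r s → Φ (f s) (f r) (r <F s) (e r))
    invA-Φ inj fi = trans (invA-cells f) (trans (ℕ∑.sum-cong-≗ (row-cells f e inj fi))
                                                (Σ²-transpose (λ s r → Φ (f s) (f r) (r <F s) (e r))))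

    inv-bottomHalf : ColumnInjective f → FreeInjection (available f) f e →
                     inv (symmetrize w) + #free f * #free f ≡ 2 * invA f + 2 * invFree f e
    inv-bottomHalf inj fi = begin
      inv (symmetrize w) + #free f * #free f
        ≡⟨ cong₂ _+_ (trans (inv-symmetrize w) (cong (λ z → (BB + z) + (0 + BB)) top-bottom-split))
                     (#*# (λ i → is-nothing (f i)) (λ i → is-nothing (f i))) ⟩
      ((BB + (TB₁ + TB₂)) + (0 + BB)) + SS
        ≡⟨ regroup BB TB₁ TB₂ SS ⟩
      BB + BB + TB₁ + TB₂ + SS
        ≡⟨ sym (trans (Σ²-+ (λ r s → bb r s + bb r s + tb₁ r s + tb₂ r s) ss)
               (cong (_+ SS) (trans (Σ²-+ (λ r s → bb r s + bb r s + tb₁ r s) tb₂)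
               (cong (_+ TB₂) (trans (Σ²-+ (λ r s → bb r s + bb r s) tb₁) (cong (_+ TB₁) (Σ²-+ bb bb))))))) ⟩
      Σ² (λ r s → bb r s + bb r s + tb₁ r s + tb₂ r s + ss r s)
        ≡⟨ Σ²-cong (λ r s → pair-identity (f r) (f s) (e r) (e s) (r <F s)) ⟩
      Σ² (λ r s → 2 * Φ (f s) (f r) (r <F s) (e r) + 2 * is r s)
        ≡⟨ trans (Σ²-+ (λ r s → 2 * Φ (f s) (f r) (r <F s) (e r)) (λ r s → 2 * is r s))
                 (cong₂ _+_ (Σ²-*ˡ 2 (λ r s → Φ (f s) (f r) (r <F s) (e r))) (Σ²-*ˡ 2 is)) ⟩
      2 * Σ² (λ r s → Φ (f s) (f r) (r <F s) (e r)) + 2 * invFree f e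
        ≡⟨ cong (λ z → 2 * z + 2 * invFree f e) (invA-Φ inj fi) ⟨
      2 * invA f + 2 * invFree f e ∎
      where
      open ≡-Reasoning
      bb tb₁ tb₂ ss is : Fin n → Fin n → ℕ
      bb  r s = χ ((r <F s) ∧ (w s <F w r))
      tb₁ r s = χ (is-nothing (f r) ∧ (w s <F opposite (w r)))
      tb₂ r s = χ (is-just (f s) ∧ (w s <F opposite (w r)))
      ss  r s = χ (is-nothing (f r) ∧ is-nothing (f s))
      is  r s = χ (is-nothing (f r) ∧ is-nothing (f s) ∧ (r <F s) ∧ (e s <F e r))
      BB TB₁ TB₂ SS : ℕ
      BB = Σ² bb
      TB₁ = Σ² tb₁
      TB₂ = Σ² tb₂
      SS = Σ² ss
      regroup : ∀ a c d s → ((a + (c + d)) + (0 + a)) + s ≡ a + a + c + d + s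
      regroup = solve-∀

    neg-bottomHalf : neg n (symmetrize w) ≡ #free f
    neg-bottomHalf = trans (count-# (λ i → (n <ᵇ suc (toℕ i)) ∧ (toℕ (symmetrize w i) <ᵇ n)))
      (trans (ℕ∑.sum-↑ n n (λ i → χ ((n <ᵇ suc (toℕ i)) ∧ (toℕ (symmetrize w i) <ᵇ n))))
             (cong₂ _+_ (#-false top) (#-cong bottom)))
      where
      top : ∀ r → (n <ᵇ suc (toℕ (r ↑ˡ n))) ∧ (toℕ (symmetrize w (r ↑ˡ n)) <ᵇ n) ≡ false
      top r = cong (_∧ (toℕ (symmetrize w (r ↑ˡ n)) <ᵇ n))
        (trans (cong (λ k → n <ᵇ suc k) (FinP.toℕ-↑ˡ r n)) (<ᵇ-false (ℕP.<⇒≱ (s≤s (FinP.toℕ<n r)))))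
      in-left : ∀ m y → (toℕ (bottomColumn m y) <ᵇ n) ≡ is-nothing m
      in-left nothing  y = trans (cong (_<ᵇ n) (FinP.toℕ-↑ˡ y n)) (<ᵇ-true (FinP.toℕ<n y))
      in-left (just c) y = trans (cong (_<ᵇ n) (FinP.toℕ-↑ʳ n c)) (<ᵇ-false (ℕP.m+n≮m n (toℕ c)))
      bottom : ∀ s → (n <ᵇ suc (toℕ (n ↑ʳ s))) ∧ (toℕ (symmetrize w (n ↑ʳ s)) <ᵇ n) ≡ is-nothing (f s)
      bottom s = cong₂ _∧_ (trans (cong (λ k → n <ᵇ suc k) (FinP.toℕ-↑ʳ n s)) (<ᵇ-true (s≤s (ℕP.m≤m+n n (toℕ s)))))
                           (trans (cong (λ z → toℕ z <ᵇ n) (symmetrize-↑ʳ w s)) (in-left (f s) (e s)))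

  _∖_ : ∀ {n} → (Fin n → Bool) → Fin n → Fin n → Bool
  (T ∖ y) t = T t ∧ not (y == t)

  #-∖ : ∀ {n} (T : Fin n → Bool) {y} → T y ≡ true → # T ≡ suc (# (T ∖ y))
  #-∖ T {y} Ty = trans (ℕ∑.sum-cong-≗ (λ t → split (T t) (y == t)))
    (trans (ℕ∑.∑-distrib-+ (λ t → χ ((y == t) ∧ T t)) (λ t → χ ((T ∖ y) t)))
           (cong (_+ # (T ∖ y)) (trans (#-singleton y T) (cong χ Ty))))
    where
    split : ∀ a b → χ a ≡ χ (b ∧ a) + χ (a ∧ not b)
    split true  true  = refl
    split true  false = refl
    split false true  = refl
    split false false = refl

  rank : ∀ {n} → (Fin n → Bool) → Fin n → ℕ
  rank T y = # (λ t → T t ∧ (t <F y))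

  module FirstRow {k n} (f : Fin (suc k) → Maybe (Fin n)) (T : Fin n → Bool) (y : Fin n) (e : Fin k → Fin n) where
    private
      f₊ : Fin k → Maybe (Fin n)
      f₊ i = f (Fin.suc i)
      y∷e : Fin (suc k) → Fin n
      y∷e = y ∷ᶠ e

    freeInjection?-rook : is-nothing (f Fin.zero) ≡ false → freeInjection? T f y∷e ≡ freeInjection? T f₊ e
    freeInjection?-rook rook = bool-ext
      (λ h → let fi = freeInjection?-sound T f y∷e h in freeInjection?-complete T f₊ e record
        { into = FreeInjection.into fi
        ; injective = λ free free' eq → FinP.suc-injective (FreeInjection.injective fi free free' eq) })
      (λ h → let fi = freeInjection?-sound T f₊ e h in freeInjection?-complete T f y∷e record
        { into = λ { {Fin.zero} free → ⊥-elim (false≢true (trans (sym rook) free))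
                   ; {Fin.suc s} free → FreeInjection.into fi free }
        ; injective = λ
          { {Fin.zero} free _ _ → ⊥-elim (false≢true (trans (sym rook) free))
          ; {Fin.suc s} {Fin.zero} _ free' _ → ⊥-elim (false≢true (trans (sym rook) free'))
          ; {Fin.suc s} {Fin.suc s'} free free' eq → cong Fin.suc (FreeInjection.injective fi free free' eq) } })

    freeInjection?-free : is-nothing (f Fin.zero) ≡ true → freeInjection? T f y∷e ≡ (T y ∧ freeInjection? (T ∖ y) f₊ e)
    freeInjection?-free free₀ = bool-ext
      (λ h → let fi = freeInjection?-sound T f y∷e h in true-∧ (FreeInjection.into fi free₀)
        (freeInjection?-complete (T ∖ y) f₊ e record
          { into = λ free → true-∧ (FreeInjection.into fi free)
                                   (true-not (λ y≡ → FinP.0≢1+n (FreeInjection.injective fi free₀ free (==-sound y≡))))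
          ; injective = λ free free' eq → FinP.suc-injective (FreeInjection.injective fi free free' eq) }))
      (λ h → let Ty , rest = ∧-true {T y} h
                 fi = freeInjection?-sound (T ∖ y) f₊ e rest
                 avoids-y : ∀ {s} → is-nothing (f₊ s) ≡ true → y ≢ e s
                 avoids-y free y≡ = not-true (proj₂ (∧-true (FreeInjection.into fi free))) (subst (λ z → (y == z) ≡ true) y≡ (==-refl y))
             in freeInjection?-complete T f y∷e record
        { into = λ { {Fin.zero} _ → Ty ; {Fin.suc s} free → proj₁ (∧-true (FreeInjection.into fi free)) }
        ; injective = λ
          { {Fin.zero} {Fin.zero} _ _ _ → refl
          ; {Fin.zero} {Fin.suc s'} _ free' eq → ⊥-elim (avoids-y free' eq)
          ; {Fin.suc s} {Fin.zero} free _ eq → ⊥-elim (avoids-y free (sym eq))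
          ; {Fin.suc s} {Fin.suc s'} free free' eq → cong Fin.suc (FreeInjection.injective fi free free' eq) } })

    private
      row : Fin k → ℕ
      row r = ℕ∑.sum (λ s → χ (is-nothing (f₊ r) ∧ is-nothing (f₊ s) ∧ (r <F s) ∧ (e s <F e r)))

    invFree-rook : is-nothing (f Fin.zero) ≡ false → invFree f y∷e ≡ invFree f₊ e
    invFree-rook rook = cong₂ _+_ first-row (ℕ∑.sum-cong-≗ first-column)
      where
      first-row : ℕ∑.sum (λ s → χ (is-nothing (f Fin.zero) ∧ is-nothing (f s) ∧ (Fin.zero <F s) ∧ (y∷e s <F y))) ≡ 0
      first-row = #-false (λ s → cong (λ b → b ∧ is-nothing (f s) ∧ (Fin.zero <F s) ∧ (y∷e s <F y)) rook)
      first-column : ∀ r → χ (is-nothing (f₊ r) ∧ is-nothing (f Fin.zero) ∧ false ∧ (y <F e r)) + row r ≡ row r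
      first-column r = cong (_+ row r) (cong χ (trans (cong (λ b → is-nothing (f₊ r) ∧ b ∧ false ∧ (y <F e r)) rook)
                                                  (𝔹.∧-zeroʳ (is-nothing (f₊ r)))))

    invFree-free : is-nothing (f Fin.zero) ≡ true → invFree f y∷e ≡ # (λ s → is-nothing (f₊ s) ∧ (e s <F y)) + invFree f₊ e
    invFree-free free₀ = cong₂ _+_ first-row (ℕ∑.sum-cong-≗ first-column)
      where
      first-row : ℕ∑.sum (λ s → χ (is-nothing (f Fin.zero) ∧ is-nothing (f s) ∧ (Fin.zero <F s) ∧ (y∷e s <F y)))
                  ≡ # (λ s → is-nothing (f₊ s) ∧ (e s <F y))
      first-row = trans (ℕ∑.sum-cong-≗ (λ s → cong (λ b → χ (b ∧ is-nothing (f s) ∧ (Fin.zero <F s) ∧ (y∷e s <F y))) free₀))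
                        (cong (λ b → χ (b ∧ false) + # (λ s → is-nothing (f₊ s) ∧ (e s <F y))) free₀)
      first-column : ∀ r → χ (is-nothing (f₊ r) ∧ is-nothing (f Fin.zero) ∧ false ∧ (y <F e r)) + row r ≡ row r
      first-column r = cong (_+ row r) (cong χ (trans (cong (λ b → is-nothing (f₊ r) ∧ b ∧ false ∧ (y <F e r)) free₀)
                                                  (𝔹.∧-zeroʳ (is-nothing (f₊ r)))))

    free-below-rank : FreeInjection (T ∖ y) f₊ e → # (T ∖ y) ≡ #free f₊ →
                      # (λ s → is-nothing (f₊ s) ∧ (e s <F y)) ≡ rank T y
    free-below-rank fi #T∖y≡#free = begin
      # (λ s → is-nothing (f₊ s) ∧ (e s <F y))
        ≡⟨ #-image (λ s → is-nothing (f₊ s)) (λ s → just (e s)) (_<F y)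
             (λ p p' e₁ e₂ → FreeInjection.injective fi p p' (just-injective (trans e₁ (sym e₂)))) ⟨
      # (λ t → ∃ᵇ (λ s → is-nothing (f₊ s) ∧ (e s == t)) ∧ (t <F y))
        ≡⟨ #-cong (λ t → cong (_∧ (t <F y)) (sym (freeInjection-onto (T ∖ y) f₊ e fi #T∖y≡#free t))) ⟩
      # (λ t → (T ∖ y) t ∧ (t <F y))
        ≡⟨ #-cong below ⟩
      rank T y ∎
      where
      open ≡-Reasoning
      below : ∀ t → (T ∖ y) t ∧ (t <F y) ≡ T t ∧ (t <F y)
      below t with t <F y in t<y | y == t in y≡t
      ... | false | _     = trans (𝔹.∧-zeroʳ _) (sym (𝔹.∧-zeroʳ _))
      ... | true  | false = cong (_∧ true) (𝔹.∧-identityʳ (T t))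
      ... | true  | true  = ⊥-elim (false≢true (trans (sym (<F-irrefl y))
                              (subst (λ z → (z <F y) ≡ true) (sym (==-sound y≡t)) t<y)))

module Powers {c ℓ} (R : CommutativeRing c ℓ) where
  open import Data.Nat as ℕ using (zero; suc)
  open import Relation.Binary.PropositionalEquality as ≡ using (_≡_)
  open CommutativeRing R
  open Eval R
  open import Algebra.Properties.Semiring.Exp semiring using (_^_; ^-homo-*)
  open import Algebra.Properties.CommutativeSemiring.Exp commutativeSemiring using (^-distrib-*)
  open import Relation.Binary.Reasoning.Setoid setoid

  pow-^ : ∀ a k → pow a k ≡ a ^ k
  pow-^ a zero    = ≡.refl
  pow-^ a (suc k) = ≡.cong (a *_) (pow-^ a k)

  pow-cong : ∀ {a b} k → a ≈ b → pow a k ≈ pow b k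
  pow-cong zero    a≈b = refl
  pow-cong (suc k) a≈b = *-cong a≈b (pow-cong k a≈b)

  pow-+ : ∀ a k l → pow a (k ℕ.+ l) ≈ pow a k * pow a l
  pow-+ a k l = begin
    pow a (k ℕ.+ l)  ≡⟨ pow-^ a (k ℕ.+ l) ⟩
    a ^ (k ℕ.+ l)    ≈⟨ ^-homo-* a k l ⟩
    a ^ k * a ^ l    ≡⟨ ≡.cong₂ _*_ (pow-^ a k) (pow-^ a l) ⟨
    pow a k * pow a l ∎

  pow-* : ∀ a b k → pow (a * b) k ≈ pow a k * pow b k
  pow-* a b k = begin
    pow (a * b) k    ≡⟨ pow-^ (a * b) k ⟩
    (a * b) ^ k      ≈⟨ ^-distrib-* a b k ⟩
    a ^ k * b ^ k    ≡⟨ ≡.cong₂ _*_ (pow-^ a k) (pow-^ b k) ⟨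
    pow a k * pow b k ∎

  pow-1# : ∀ k → pow 1# k ≈ 1#
  pow-1# zero    = refl
  pow-1# (suc k) = trans (*-identityˡ _) (pow-1# k)

module QFactorial {c ℓ} (R : CommutativeRing c ℓ) (x : CommutativeRing.Carrier R) where
  open import Data.Bool using (Bool; true; false; if_then_else_; _∧_)
  import Data.Bool.Properties as 𝔹
  open import Data.Nat as ℕ using (zero; suc)
  import Data.Nat.Properties as ℕP
  open import Data.Fin as Fin using ()
  open import Data.Maybe using (Maybe; just; nothing; is-nothing)
  open import Data.List using (List; allFin)
  open import Data.Vec.Functional using () renaming (_∷_ to _∷ᶠ_)
  open import Data.Product using (proj₂)
  open import Relation.Binary.PropositionalEquality as ≡ using (_≡_; _≢_)
  open CommutativeRing R
  open import Algebra.Solver.Ring.NaturalCoefficients.Default commutativeSemiring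
  open Eval R
  open FinSum semiring
  open ListSums R
  open Powers R
  open Counting using (χ; #_; ==-refl; ==-false; ∧-true)
  open TypeB using (consistent; agrees; freeInjection?; freeInjection?-sound)
  open Statistics using (#free; invFree; rank; _∖_; #-∖; module FirstRow)
  open import Relation.Binary.Reasoning.Setoid setoid

  qint-suc : ∀ m → qint x (suc m) ≈ 1# + x * qint x m
  qint-suc zero    = trans (+-identityˡ 1#) (sym (trans (+-congˡ (zeroʳ x)) (+-identityʳ 1#)))
  qint-suc (suc m) = begin
    qint x (suc m) + x * pow x m          ≈⟨ +-congʳ (qint-suc m) ⟩
    (1# + x * qint x m) + x * pow x m     ≈⟨ solve 3 (λ x q p → (con 1 :+ x :* q) :+ x :* p := con 1 :+ x :* (q :+ p))
                                                     refl x (qint x m) (pow x m) ⟩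
    1# + x * (qint x m + pow x m)         ∎

  sum-pow-rank : ∀ {n} (T : Fin n → Bool) a → sum (λ y → if T y then pow x (a ℕ.+ rank T y) else 0#) ≈ pow x a * qint x (# T)
  sum-pow-rank {zero}  T a = sym (zeroʳ _)
  sum-pow-rank {suc n} T a = begin
    (if T Fin.zero then pow x (a ℕ.+ rank T Fin.zero) else 0#) + sum (λ y → if T (Fin.suc y) then pow x (a ℕ.+ rank T (Fin.suc y)) else 0#)
      ≡⟨ ≡.cong₂ _+_ (≡.cong (λ r → if T Fin.zero then pow x (a ℕ.+ r) else 0#) rank-zero)
                     (sum-cong-≗ (λ y → ≡.cong (λ r → if T (Fin.suc y) then pow x r else 0#) (rank-suc y))) ⟩
    (if T Fin.zero then pow x (a ℕ.+ 0) else 0#) + sum (λ y → if T₊ y then pow x ((a ℕ.+ χ (T Fin.zero)) ℕ.+ rank T₊ y) else 0#)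
      ≈⟨ +-congˡ (sum-pow-rank T₊ (a ℕ.+ χ (T Fin.zero))) ⟩
    (if T Fin.zero then pow x (a ℕ.+ 0) else 0#) + pow x (a ℕ.+ χ (T Fin.zero)) * qint x (# T₊)
      ≈⟨ by-first (T Fin.zero) ⟩
    pow x a * qint x (χ (T Fin.zero) ℕ.+ # T₊) ∎
    where
    T₊ : Fin n → Bool
    T₊ t = T (Fin.suc t)
    rank-zero : rank T Fin.zero ≡ 0
    rank-zero = Counting.#-false (λ t → 𝔹.∧-zeroʳ (T t))
    rank-suc : ∀ y → a ℕ.+ rank T (Fin.suc y) ≡ (a ℕ.+ χ (T Fin.zero)) ℕ.+ rank T₊ y
    rank-suc y = ≡.trans (≡.cong (λ b → a ℕ.+ (χ b ℕ.+ rank T₊ y)) (𝔹.∧-identityʳ (T Fin.zero))) (≡.sym (ℕP.+-assoc a _ _))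
    by-first : ∀ b → (if b then pow x (a ℕ.+ 0) else 0#) + pow x (a ℕ.+ χ b) * qint x (# T₊) ≈ pow x a * qint x (χ b ℕ.+ # T₊)
    by-first true = begin
      pow x (a ℕ.+ 0) + pow x (a ℕ.+ 1) * qint x (# T₊)
        ≈⟨ +-cong (reflexive (≡.cong (pow x) (ℕP.+-identityʳ a))) (*-congʳ (pow-+ x a 1)) ⟩
      pow x a + (pow x a * (x * 1#)) * qint x (# T₊)
        ≈⟨ solve 3 (λ p x q → p :+ (p :* (x :* con 1)) :* q := p :* (con 1 :+ x :* q)) refl (pow x a) x (qint x (# T₊)) ⟩
      pow x a * (1# + x * qint x (# T₊)) ≈⟨ *-congˡ (sym (qint-suc (# T₊))) ⟩
      pow x a * qint x (suc (# T₊)) ∎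
    by-first false = trans (+-identityˡ _) (*-congʳ (reflexive (≡.cong (pow x) (ℕP.+-identityʳ a))))

  weight : ∀ {k n} → (Fin k → Maybe (Fin n)) → (Fin n → Bool) → (Fin k → Fin n) → Carrier
  weight f T e = if consistent f e ∧ freeInjection? T f e then pow x (invFree f e) else 0#

  injectionSum : ∀ {k n} → (Fin k → Maybe (Fin n)) → (Fin n → Bool) → Carrier
  injectionSum {k} {n} f T = sumL (allFuns k (allFin n)) (weight f T)

  private
    if-factor : ∀ b {E E' : ℕ} {P : Carrier} → (b ≡ true → pow x E ≈ P * pow x E') →
                (if b then pow x E else 0#) ≈ P * (if b then pow x E' else 0#)
    if-factor true  h = h ≡.refl
    if-factor false h = sym (zeroʳ _)

  module _ {k n} (f : Fin (suc k) → Maybe (Fin n)) (T : Fin n → Bool) where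
    private
      f₊ : Fin k → Maybe (Fin n)
      f₊ i = f (Fin.suc i)
      Es : List (Fin k → Fin n)
      Es = allFuns k (allFin n)

    injectionSum-suc : injectionSum f T ≈ sum (λ y → sumL Es (λ e → weight f T (y ∷ᶠ e)))
    injectionSum-suc = trans (sumL-allFuns-suc k (allFin n) (weight f T)) (reflexive (sumL-allFin {n} _))

    injectionSum-rook : ∀ {c} → f Fin.zero ≡ just c → injectionSum f T ≈ injectionSum f₊ T
    injectionSum-rook {c} f₀ = begin
      injectionSum f T                                     ≈⟨ injectionSum-suc ⟩
      sum (λ y → sumL Es (λ e → weight f T (y ∷ᶠ e)))      ≈⟨ sum-eq-single _ c (λ y y≢c → sumL-zero Es (off-rook y y≢c)) ⟩
      sumL Es (λ e → weight f T (c ∷ᶠ e))                  ≈⟨ sumL-cong Es (λ e → reflexive (at-rook e)) ⟩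
      injectionSum f₊ T                                    ∎
      where
      rook : is-nothing (f Fin.zero) ≡ false
      rook = ≡.cong is-nothing f₀
      off-rook : ∀ y → y ≢ c → ∀ e → weight f T (y ∷ᶠ e) ≈ 0#
      off-rook y y≢c e = reflexive (𝔹.if-cong (≡.trans
        (≡.cong (λ m → (agrees m y ∧ consistent f₊ e) ∧ freeInjection? T f (y ∷ᶠ e)) f₀)
        (≡.cong (λ b → (b ∧ consistent f₊ e) ∧ freeInjection? T f (y ∷ᶠ e)) (==-false (λ c≡y → y≢c (≡.sym c≡y))))))
      at-rook : ∀ e → weight f T (c ∷ᶠ e) ≡ weight f₊ T e
      at-rook e = ≡.trans (𝔹.if-cong (≡.trans
          (≡.cong (λ m → (agrees m c ∧ consistent f₊ e) ∧ freeInjection? T f (c ∷ᶠ e)) f₀)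
          (≡.cong₂ (λ b g → (b ∧ consistent f₊ e) ∧ g) (==-refl c) (FirstRow.freeInjection?-rook f T c e rook))))
        (≡.cong (λ i → if consistent f₊ e ∧ freeInjection? T f₊ e then pow x i else 0#) (FirstRow.invFree-rook f T c e rook))

    module _ (f₀ : f Fin.zero ≡ nothing) where
      private
        free : is-nothing (f Fin.zero) ≡ true
        free = ≡.cong is-nothing f₀

      free-condition : ∀ y e → (consistent f (y ∷ᶠ e) ∧ freeInjection? T f (y ∷ᶠ e))
                               ≡ (consistent f₊ e ∧ (T y ∧ freeInjection? (T ∖ y) f₊ e))
      free-condition y e = ≡.trans (≡.cong (λ m → (agrees m y ∧ consistent f₊ e) ∧ freeInjection? T f (y ∷ᶠ e)) f₀)
                                   (≡.cong (consistent f₊ e ∧_) (FirstRow.freeInjection?-free f T y e free))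

      weight-unavailable : ∀ {y} → T y ≡ false → ∀ e → weight f T (y ∷ᶠ e) ≈ 0#
      weight-unavailable {y} Ty e = reflexive (𝔹.if-cong (≡.trans (free-condition y e)
        (≡.trans (≡.cong (λ b → consistent f₊ e ∧ (b ∧ freeInjection? (T ∖ y) f₊ e)) Ty) (𝔹.∧-zeroʳ _))))

      weight-available : ∀ {y} → T y ≡ true → # (T ∖ y) ≡ #free f₊ → ∀ e →
                         weight f T (y ∷ᶠ e) ≈ pow x (rank T y) * weight f₊ (T ∖ y) e
      weight-available {y} Ty #T∖y e = trans
        (reflexive (𝔹.if-cong (≡.trans (free-condition y e)
          (≡.cong (λ b → consistent f₊ e ∧ (b ∧ freeInjection? (T ∖ y) f₊ e)) Ty))))
        (if-factor (consistent f₊ e ∧ freeInjection? (T ∖ y) f₊ e) {invFree f (y ∷ᶠ e)} {invFree f₊ e} λ holds → begin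
          pow x (invFree f (y ∷ᶠ e))
            ≡⟨ ≡.cong (pow x) (≡.trans (FirstRow.invFree-free f T y e free)
                 (≡.cong (ℕ._+ invFree f₊ e) (FirstRow.free-below-rank f T y e
                   (freeInjection?-sound (T ∖ y) f₊ e (proj₂ (∧-true {consistent f₊ e} holds))) #T∖y))) ⟩
          pow x (rank T y ℕ.+ invFree f₊ e)
            ≈⟨ pow-+ x (rank T y) (invFree f₊ e) ⟩
          pow x (rank T y) * pow x (invFree f₊ e) ∎)

      injectionSum-free : # T ≡ suc (#free f₊) → (∀ T' → # T' ≡ #free f₊ → injectionSum f₊ T' ≈ qfact x (#free f₊)) →
                          injectionSum f T ≈ qint x (# T) * qfact x (#free f₊)
      injectionSum-free #T ih = begin
        injectionSum f T
          ≈⟨ injectionSum-suc ⟩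
        sum (λ y → sumL Es (λ e → weight f T (y ∷ᶠ e)))
          ≈⟨ sum-cong-≋ (λ y → column y (T y) ≡.refl) ⟩
        sum (λ y → (if T y then pow x (rank T y) else 0#) * qfact x (#free f₊))
          ≈⟨ *-distribʳ-sum (qfact x (#free f₊)) (λ y → if T y then pow x (rank T y) else 0#) ⟨
        sum (λ y → if T y then pow x (0 ℕ.+ rank T y) else 0#) * qfact x (#free f₊)
          ≈⟨ *-congʳ (trans (sum-pow-rank T 0) (*-identityˡ _)) ⟩
        qint x (# T) * qfact x (#free f₊) ∎
        where
        column : ∀ y b → T y ≡ b → sumL Es (λ e → weight f T (y ∷ᶠ e)) ≈ (if b then pow x (rank T y) else 0#) * qfact x (#free f₊)
        column y false Ty = trans (sumL-zero Es (weight-unavailable Ty)) (sym (zeroˡ _))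
        column y true  Ty = begin
          sumL Es (λ e → weight f T (y ∷ᶠ e))                    ≈⟨ sumL-cong Es (weight-available Ty #T∖y) ⟩
          sumL Es (λ e → pow x (rank T y) * weight f₊ (T ∖ y) e) ≈⟨ *-distribˡ-sumL Es _ _ ⟨
          pow x (rank T y) * injectionSum f₊ (T ∖ y)            ≈⟨ *-congˡ (ih (T ∖ y) #T∖y) ⟩
          pow x (rank T y) * qfact x (#free f₊)                 ∎
          where
          #T∖y : # (T ∖ y) ≡ #free f₊
          #T∖y = ℕP.suc-injective (≡.trans (≡.sym (#-∖ T Ty)) #T)

  injectionSum-qfact : ∀ k {n} (f : Fin k → Maybe (Fin n)) (T : Fin n → Bool) → # T ≡ #free f →
                       injectionSum f T ≈ qfact x (#free f)
  injectionSum-qfact zero    f T _  = +-identityʳ _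
  injectionSum-qfact (suc k) f T #T = by-first-row (f Fin.zero) ≡.refl
    where
    f₊ : Fin k → Maybe (Fin _)
    f₊ i = f (Fin.suc i)
    by-first-row : ∀ m → f Fin.zero ≡ m → injectionSum f T ≈ qfact x (#free f)
    by-first-row (just c) f₀ = begin
      injectionSum f T     ≈⟨ injectionSum-rook f T f₀ ⟩
      injectionSum f₊ T    ≈⟨ injectionSum-qfact k f₊ T (≡.trans #T #free≡) ⟩
      qfact x (#free f₊)   ≡⟨ ≡.cong (qfact x) #free≡ ⟨
      qfact x (#free f)    ∎
      where
      #free≡ : #free f ≡ #free f₊
      #free≡ = ≡.cong (λ m → χ (is-nothing m) ℕ.+ #free f₊) f₀
    by-first-row nothing f₀ = begin
      injectionSum f T                     ≈⟨ injectionSum-free f T f₀ (≡.trans #T #free≡) (injectionSum-qfact k f₊) ⟩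
      qint x (# T) * qfact x (#free f₊)    ≈⟨ *-comm _ _ ⟩
      qfact x (#free f₊) * qint x (# T)    ≡⟨ ≡.cong (λ i → qfact x (#free f₊) * qint x i) (≡.trans #T #free≡) ⟩
      qfact x (suc (#free f₊))             ≡⟨ ≡.cong (qfact x) #free≡ ⟨
      qfact x (#free f)                    ∎
      where
      #free≡ : #free f ≡ suc (#free f₊)
      #free≡ = ≡.cong (λ m → χ (is-nothing m) ℕ.+ #free f₊) f₀

module Proof {c ℓ} (R : CommutativeRing c ℓ) (n : ℕ) (A : Mat n n) (q q⁻¹ t : CommutativeRing.Carrier R)
             (qq⁻¹≈1 : CommutativeRing._≈_ R (CommutativeRing._*_ R q q⁻¹) (CommutativeRing.1# R)) where
  open import Data.Bool using (true; false; if_then_else_; _∧_)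
  import Data.Bool.Properties as 𝔹
  import Data.Nat as ℕ
  import Data.Nat.Properties as ℕP
  open import Data.Fin using (opposite; _↑ˡ_; _↑ʳ_)
  open import Data.Maybe using (Maybe; just; nothing)
  open import Data.List using (List; _∷_; map; allFin)
  open import Data.Vec.Functional using () renaming (_++_ to _++ᶠ_)
  open import Data.Vec.Functional.Properties using (++-cong)
  open import Data.Maybe using (is-just)
  open import Relation.Nullary using (does)
  open import Relation.Nullary.Decidable using (dec-true; dec-false)
  open import Relation.Binary.PropositionalEquality as ≡ using (_≡_; _≢_)
  open CommutativeRing R
  open import Algebra.Solver.Ring.NaturalCoefficients.Default commutativeSemiring
  open Eval R
  open FinSum semiring
  open ListSums R
  open Powers R
  open Counting using (#_; ==-refl; ==-false)
  open TypeB
  open Statistics using (#free; invFree; inv-cong; neg-cong; rooks-#; #rooks+#free; #available; inv-bottomHalf; neg-bottomHalf)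
  open import Relation.Binary.Reasoning.Setoid setoid

  x : Carrier
  x = q * q

  open QFactorial R x using (weight; injectionSum; injectionSum-qfact)

  private
    N : ℕ
    N = n ℕ.+ n
    C : Mat N N
    C = rot A # A
    Fs : List (Fin N)
    Fs = allFin N
    Ms : List (Maybe (Fin n))
    Ms = nothing ∷ map just (allFin n)
    Es : List (Fin n → Fin n)
    Es = allFuns n (allFin n)

  monomial : (Fin N → Fin N) → Carrier
  monomial π = pow q (inv π) * pow t (neg n π)

  monomial-cong : ∀ {π π'} → (∀ i → π i ≡ π' i) → monomial π ≈ monomial π'
  monomial-cong π≗π' = reflexive (≡.cong₂ _*_ (≡.cong (pow q) (inv-cong π≗π')) (≡.cong (pow t) (neg-cong n π≗π')))

  bottomWeight : (Fin n → Fin N) → Carrier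
  bottomWeight w = if isPerm (symmetrize w) ∧ inS C (symmetrize w) then monomial (symmetrize w) else 0#

  valid-cong : ∀ {π π' : Fin N → Fin N} → (∀ i → π i ≡ π' i) → (isPerm π ∧ inS C π) ≡ (isPerm π' ∧ inS C π')
  valid-cong π≗π' = ≡.cong₂ _∧_ (isPerm-cong π≗π') (inS-cong C π≗π')

  RB-bottomHalves : RB n C q t ≈ sumL (allFuns n Fs) bottomWeight
  RB-bottomHalves = begin
    RB n C q t
      ≈⟨ sumL-filter isPerm (allFuns N Fs) _ ⟩
    sumL (allFuns N Fs) G
      ≈⟨ sumL-allFuns-++ n n Fs G (λ π≗π' → guarded-cong (isPerm-cong π≗π')
           (guarded-cong (≡.cong₂ _∧_ (isTypeB-cong π≗π') (inS-cong C π≗π')) (monomial-cong π≗π'))) ⟩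
    sumL (allFuns n Fs) (λ u → sumL (allFuns n Fs) (λ w → G (u ++ᶠ w)))
      ≈⟨ sumL-comm (allFuns n Fs) (allFuns n Fs) _ ⟩
    sumL (allFuns n Fs) (λ w → sumL (allFuns n Fs) (λ u → G (u ++ᶠ w)))
      ≈⟨ sumL-cong (allFuns n Fs) top-half-determined ⟩
    sumL (allFuns n Fs) bottomWeight ∎
    where
    G : (Fin N → Fin N) → Carrier
    G π = if isPerm π then (if isTypeB π ∧ inS C π then monomial π else 0#) else 0#
    top-half-determined : ∀ w → sumL (allFuns n Fs) (λ u → G (u ++ᶠ w)) ≈ bottomWeight w
    top-half-determined w = trans
      (sumL-cong (allFuns n Fs) (λ u → reflexive (swap-guards (isPerm (u ++ᶠ w)) (isTypeB (u ++ᶠ w)))))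
      (sumL-allFuns-unique n (λ u → isTypeB (u ++ᶠ w)) H (mirror w) (λ u → isTypeB-++ᶠ u w) (λ u → mirror-isTypeB u w)
        (λ u≗u' → let s≗s' = ++-cong _ _ u≗u' (λ _ → ≡.refl)
                  in guarded-cong (valid-cong s≗s') (monomial-cong s≗s')))
      where
      H : (Fin n → Fin N) → Carrier
      H u = if isPerm (u ++ᶠ w) ∧ inS C (u ++ᶠ w) then monomial (u ++ᶠ w) else 0#
      swap-guards : ∀ a b {c} {X : Carrier} →
                    (if a then (if b ∧ c then X else 0#) else 0#) ≡ (if b then (if a ∧ c then X else 0#) else 0#)
      swap-guards true  true  = ≡.refl
      swap-guards true  false = ≡.refl
      swap-guards false true  = ≡.refl
      swap-guards false false = ≡.refl

  bottom-fibres : ∀ (h : Fin N → Carrier) →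
                  sumL Fs h ≈ sumL Ms (λ m → sumL (allFin n) (λ z → if agrees m z then h (bottomColumn m z) else 0#))
  bottom-fibres h = begin
    sumL Fs h
      ≡⟨ sumL-allFin h ⟩
    sum h
      ≈⟨ sum-↑ n n h ⟩
    sum (λ z → h (z ↑ˡ n)) + sum (λ c → h (n ↑ʳ c))
      ≈⟨ +-cong (reflexive (≡.sym (sumL-allFin (λ z → h (z ↑ˡ n)))))
                (sym (trans (reflexive (sumL-allFin (λ c → F (just c)))) (sum-cong-≋ at-rook))) ⟩
    F nothing + sumL (allFin n) (λ c → F (just c))
      ≡⟨ ≡.cong (F nothing +_) (≡.sym (sumL-map just (allFin n) F)) ⟩
    sumL Ms F ∎
    where
    F : Maybe (Fin n) → Carrier
    F m = sumL (allFin n) (λ z → if agrees m z then h (bottomColumn m z) else 0#)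
    at-rook : ∀ c → F (just c) ≈ h (n ↑ʳ c)
    at-rook c = trans (reflexive (sumL-allFin (λ z → if c == z then h (n ↑ʳ c) else 0#)))
      (trans (sum-eq-single _ c (λ z z≢c → reflexive (𝔹.if-cong (==-false (λ c≡z → z≢c (≡.sym c≡z))))))
             (reflexive (𝔹.if-cong (==-refl c))))

  bottomHalves-rooks : sumL (allFuns n Fs) bottomWeight
    ≈ sumL (allFuns n Ms) (λ f → sumL Es (λ e → if consistent f e then bottomWeight (bottomHalf f e) else 0#))
  bottomHalves-rooks = sumL-allFuns-fibres n Fs Ms (allFin n) agrees bottomColumn bottom-fibres bottomWeight
    (λ {w} {w'} w≗w' → let s≗s' = ++-cong (mirror w) (mirror w') (λ r → ≡.cong opposite (w≗w' (opposite r))) w≗w'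
                       in guarded-cong (valid-cong s≗s') (monomial-cong s≗s'))

  pow-q-exponent : ∀ a b₁ b₂ k → a ℕ.+ k ≡ 2 ℕ.* b₁ ℕ.+ 2 ℕ.* b₂ → pow q a ≈ (pow x b₁ * pow x b₂) * pow q⁻¹ k
  pow-q-exponent a b₁ b₂ k eq = begin
    pow q a                               ≈⟨ *-identityʳ _ ⟨
    pow q a * 1#                          ≈⟨ *-congˡ (trans (pow-cong k qq⁻¹≈1) (pow-1# k)) ⟨
    pow q a * pow (q * q⁻¹) k             ≈⟨ *-congˡ (pow-* q q⁻¹ k) ⟩
    pow q a * (pow q k * pow q⁻¹ k)       ≈⟨ *-assoc _ _ _ ⟨
    (pow q a * pow q k) * pow q⁻¹ k       ≈⟨ *-congʳ (pow-+ q a k) ⟨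
    pow q (a ℕ.+ k) * pow q⁻¹ k           ≡⟨ ≡.cong (λ z → pow q z * pow q⁻¹ k) eq ⟩
    pow q (2 ℕ.* b₁ ℕ.+ 2 ℕ.* b₂) * pow q⁻¹ k
      ≈⟨ *-congʳ (trans (pow-+ q (2 ℕ.* b₁) (2 ℕ.* b₂)) (*-cong (pow-double b₁) (pow-double b₂))) ⟩
    (pow x b₁ * pow x b₂) * pow q⁻¹ k     ∎
    where
    pow-double : ∀ b → pow q (2 ℕ.* b) ≈ pow x b
    pow-double b = begin
      pow q (b ℕ.+ (b ℕ.+ 0))   ≡⟨ ≡.cong (λ z → pow q (b ℕ.+ z)) (ℕP.+-identityʳ b) ⟩
      pow q (b ℕ.+ b)           ≈⟨ pow-+ q b b ⟩
      pow q b * pow q b         ≈⟨ pow-* q q b ⟨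
      pow x b                   ∎

  freeFactor : ℕ → Carrier
  freeFactor i = qfact x i * pow q⁻¹ (i ℕ.* i) * pow t i

  rookWeight : (Fin n → Maybe (Fin n)) → Carrier
  rookWeight f = if isRookConf A f then pow x (invA f) * freeFactor (#free f) else 0#

  module _ (f : Fin n → Maybe (Fin n)) (rook : isRookConf A f ≡ true) where
    private
      i : ℕ
      i = #free f
      D : Carrier
      D = pow x (invA f) * (pow q⁻¹ (i ℕ.* i) * pow t i)
      rp : IsRookPlacement A f
      rp = isRookConf-sound A f rook

    monomial-valid : ∀ e → freeInjection? (available f) f e ≡ true →
                     monomial (symmetrize (bottomHalf f e)) ≈ pow x (invFree f e) * D
    monomial-valid e fi = begin
      pow q (inv π) * pow t (neg n π)
        ≈⟨ *-cong (pow-q-exponent (inv π) (invA f) (invFree f e) (i ℕ.* i)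
                     (inv-bottomHalf f e (IsRookPlacement.injective rp) (freeInjection?-sound (available f) f e fi)))
                  (reflexive (≡.cong (pow t) (neg-bottomHalf f e))) ⟩
      ((pow x (invA f) * pow x (invFree f e)) * pow q⁻¹ (i ℕ.* i)) * pow t i
        ≈⟨ solve 4 (λ a s c d → ((a :* s) :* c) :* d := s :* (a :* (c :* d))) refl
                   (pow x (invA f)) (pow x (invFree f e)) (pow q⁻¹ (i ℕ.* i)) (pow t i) ⟩
      pow x (invFree f e) * D ∎
      where π = symmetrize (bottomHalf f e)

    fibre-weight : ∀ e → (if consistent f e then bottomWeight (bottomHalf f e) else 0#) ≈ weight f (available f) e * D
    fibre-weight e with consistent f e | freeInjection? (available f) f e in fi
                      | isPerm∧inS≡isRookConf∧freeInjection? A f e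
    ... | false | _     | _     = sym (zeroˡ D)
    ... | true  | false | valid = trans (reflexive (𝔹.if-cong (≡.trans valid (≡.cong (_∧ false) rook)))) (sym (zeroˡ D))
    ... | true  | true  | valid = trans (reflexive (𝔹.if-cong (≡.trans valid (≡.cong (_∧ true) rook)))) (monomial-valid e fi)

    fibre-sum-rook : sumL Es (λ e → if consistent f e then bottomWeight (bottomHalf f e) else 0#) ≈ pow x (invA f) * freeFactor i
    fibre-sum-rook = begin
      sumL Es (λ e → if consistent f e then bottomWeight (bottomHalf f e) else 0#)
        ≈⟨ sumL-cong Es fibre-weight ⟩
      sumL Es (λ e → weight f (available f) e * D)
        ≈⟨ *-distribʳ-sumL Es D _ ⟨
      injectionSum f (available f) * D
        ≈⟨ *-congʳ (injectionSum-qfact n f (available f) (#available f (IsRookPlacement.injective rp))) ⟩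
      qfact x i * D
        ≈⟨ solve 4 (λ a b c d → b :* (a :* (c :* d)) := a :* ((b :* c) :* d)) refl
                   (pow x (invA f)) (qfact x i) (pow q⁻¹ (i ℕ.* i)) (pow t i) ⟩
      pow x (invA f) * freeFactor i ∎

  fibre-sum : ∀ f → sumL Es (λ e → if consistent f e then bottomWeight (bottomHalf f e) else 0#) ≈ rookWeight f
  fibre-sum f with isRookConf A f in rook
  ... | true  = fibre-sum-rook f rook
  ... | false = sumL-zero Es (λ e → vanish e (consistent f e))
    where
    vanish : ∀ e b → (if b then bottomWeight (bottomHalf f e) else 0#) ≈ 0#
    vanish e false = refl
    vanish e true  = reflexive (𝔹.if-cong (≡.trans (isPerm∧inS≡isRookConf∧freeInjection? A f e)
                                                   (≡.cong (_∧ freeInjection? (available f) f e) rook)))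

  RB-rooks : RB n (rot A # A) q t ≈ sumL (allFuns n Ms) rookWeight
  RB-rooks = trans RB-bottomHalves (trans bottomHalves-rooks (sumL-cong (allFuns n Ms) fibre-sum))

  rookTerm : (Fin n → Maybe (Fin n)) → ℕ → Carrier
  rookTerm f i = if isRookConf A f then (if does (rooks f ℕ.≟ (n ∸ i)) then pow x (invA f) * freeFactor i else 0#) else 0#

  RA-rookTerms : ∀ i → RA A (n ∸ i) x * qfact x i * pow q⁻¹ (i ℕ.* i) * pow t i ≈ sumL (allFuns n Ms) (λ f → rookTerm f i)
  RA-rookTerms i = begin
    RA A (n ∸ i) x * qfact x i * pow q⁻¹ (i ℕ.* i) * pow t i
      ≈⟨ solve 4 (λ r a b c → ((r :* a) :* b) :* c := r :* ((a :* b) :* c)) refl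
                 (RA A (n ∸ i) x) (qfact x i) (pow q⁻¹ (i ℕ.* i)) (pow t i) ⟩
    RA A (n ∸ i) x * freeFactor i
      ≈⟨ *-congʳ (sumL-filter (isRookConf A) (allFuns n Ms) _) ⟩
    sumL (allFuns n Ms) (λ f → if isRookConf A f then term f else 0#) * freeFactor i
      ≈⟨ *-distribʳ-sumL (allFuns n Ms) (freeFactor i) _ ⟩
    sumL (allFuns n Ms) (λ f → (if isRookConf A f then term f else 0#) * freeFactor i)
      ≈⟨ sumL-cong (allFuns n Ms) (λ f → guarded-*ʳ (isRookConf A f) (does (rooks f ℕ.≟ (n ∸ i)))) ⟩
    sumL (allFuns n Ms) (λ f → rookTerm f i) ∎
    where
    term : (Fin n → Maybe (Fin n)) → Carrier
    term f = if does (rooks f ℕ.≟ (n ∸ i)) then pow x (invA f) else 0#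
    guarded-*ʳ : ∀ a b {X Y} → (if a then (if b then X else 0#) else 0#) * Y ≈ (if a then (if b then X * Y else 0#) else 0#)
    guarded-*ʳ true  true  = refl
    guarded-*ʳ true  false = zeroˡ _
    guarded-*ʳ false _     = zeroˡ _

  rookTerms-rookWeight : ∀ f → sumTo n (rookTerm f) ≈ rookWeight f
  rookTerms-rookWeight f with isRookConf A f
  ... | false = sumTo-zero n (λ _ _ → refl)
  ... | true  = trans (sumTo-eq-single n _ i₀≤n off-i₀) (reflexive (𝔹.if-cong (dec-true (rooks f ℕ.≟ (n ∸ i₀)) rooks≡)))
    where
    i₀ : ℕ
    i₀ = #free f
    total : # (λ i → is-just (f i)) ℕ.+ i₀ ≡ n
    total = #rooks+#free f
    i₀≤n : i₀ ℕ.≤ n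
    i₀≤n = ≡.subst (i₀ ℕ.≤_) total (ℕP.m≤n+m i₀ _)
    rooks≡ : rooks f ≡ n ∸ i₀
    rooks≡ = ≡.trans (rooks-# f) (≡.trans (≡.sym (ℕP.m+n∸n≡m _ i₀)) (≡.cong (_∸ i₀) total))
    off-i₀ : ∀ i → i ℕ.≤ n → i ≢ i₀ → (if does (rooks f ℕ.≟ (n ∸ i)) then pow x (invA f) * freeFactor i else 0#) ≈ 0#
    off-i₀ i i≤n i≢i₀ = reflexive (𝔹.if-cong (dec-false (rooks f ℕ.≟ (n ∸ i)) λ rooks≡n∸i →
      i≢i₀ (ℕP.+-cancelˡ-≡ (# (λ k → is-just (f k))) i i₀
        (≡.trans (≡.cong (ℕ._+ i) (≡.trans (≡.sym (rooks-# f)) rooks≡n∸i)) (≡.trans (ℕP.m∸n+n≡m i≤n) (≡.sym total))))))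

  sumTo-rooks : sumTo n (λ i → RA A (n ∸ i) x * qfact x i * pow q⁻¹ (i ℕ.* i) * pow t i) ≈ sumL (allFuns n Ms) rookWeight
  sumTo-rooks = trans (sumTo-cong n RA-rookTerms)
    (trans (sumTo-sumL n (allFuns n Ms) (λ i f → rookTerm f i)) (sumL-cong (allFuns n Ms) rookTerms-rookWeight))

proposition7p1 : {c ℓ : Level} (R : CommutativeRing c ℓ) (n : ℕ) (A : Mat n n)
    (q q⁻¹ t : CommutativeRing.Carrier R) →
    CommutativeRing._≈_ R (CommutativeRing._*_ R q q⁻¹) (CommutativeRing.1# R) →
    let open CommutativeRing R
        open Eval R
    in RB n (rot A # A) q t
       ≈ sumTo n (λ i → RA A (n ∸ i) (q * q) * qfact (q * q) i
                          * pow q⁻¹ (i Data.Nat.* i) * pow t i)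
proposition7p1 R n A q q⁻¹ t qq⁻¹≈1 = trans RB-rooks (sym sumTo-rooks)
  where
  open CommutativeRing R
  open Proof R n A q q⁻¹ t qq⁻¹≈1
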